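{- Let $L$ be a language over a finite alphabet $\Sigma$ and let $\mathcal D\in\{\mathrm{UDynProp},\mathrm{UDyn}\Sigma_1^+\}$. If $\mathrm{Member}(L)\in\mathcal D$, then (1) $\mathrm{Member}(h^{ -1}(L))\in\mathcal D$ for every finite alphabet $\Gamma$ and every mapping $h:\Gamma\to\Sigma^*$ (extended letter-wise to a morphism $\Gamma^*\to\Sigma^*$), and (2) $\mathrm{Member}(L\sigma^{ -1})\in\mathcal D$ and $\mathrm{Member}(\sigma^{ -1}L)\in\mathcal D$ for every $\sigma\in\Sigma$, where $L\sigma^{ -1}=\{w: w\sigma\in L\}$ and $\sigma^{ -1}L=\{w:\sigma w\in L\}$.
   Context: Dynamic descriptive complexity: a word $w_1\cdots w_n$, $w_i\in\Sigma\cup\{\epsilon\}$, is encoded on domain $\{1,\dots,n\}$ with unary relations $W_\sigma$ (each position in at most one) and the order $\le$; the represented word is the concatenation of non-$\epsilon$ symbols. Changes $\mathrm{set}_\sigma(i)$ set position $i$ to $\sigma\in\Sigma\cup\{\epsilon\}$. A dynamic program has, for each auxiliary relation $R$ and each $\sigma$, an update formula $\varphi^R_\sigma(\bar x;y)$; after $\mathrm{set}_\sigma(i)$, new $R=\{\bar a:\varphi^R_\sigma(\bar a;i)$ holds in (changed word, old auxiliary relations)$\}$. Initially the word is $\epsilon^n$ and auxiliary relations are first-order definable. It maintains $\mathrm{Member}(L)$ if a distinguished $0$-ary relation is true iff the current word is in $L$ after every change sequence. $\mathrm{UDynProp}$: auxiliary relations of arity $\le1$, quantifier-free update formulas. $\mathrm{UDyn}\Sigma_1^+$: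 auxiliary relations of arity $\le1$, update formulas in prenex form $\exists^*$ with negation only directly in front of atoms $x\le y$. -}

module Defs where

open import Data.Nat using (ℕ; zero; suc)
open import Data.Fin using (Fin; zero; suc; _≟_; _≤?_)
open import Data.List using (List; []; _∷_; _++_; concatMap; allFin; map; foldl)
open import Data.Maybe using (Maybe; just; nothing)
open import Data.Bool using (Bool; true; false; _∧_; _∨_; not)
open import Data.Product using (Σ; _×_; _,_)
open import Relation.Nullary.Decidable using (⌊_⌋)
open import Function.Bundles using (_⇔_)
open import Relation.Nullary using (yes; no)
open import Relation.Binary.PropositionalEquality using (_≡_)

-- Alphabets are Fin k.  A symbol of Σ ∪ {ε} is a Maybe (Fin k),
-- with nothing = ε.

-- First-order formulas over the vocabulary
--   { W_σ (σ : Fin k) unary, ≤ binary,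
--     a0 nullary auxiliary relations, a1 unary auxiliary relations }
-- with m free variables (variables are Fin m; ∃ binds variable zero
-- and shifts the others).
data Formula (k a0 a1 : ℕ) : ℕ → Set where
  wAtom : ∀ {m} → Fin k → Fin m → Formula k a0 a1 m
  leq   : ∀ {m} → Fin m → Fin m → Formula k a0 a1 m
  nul   : ∀ {m} → Fin a0 → Formula k a0 a1 m
  una   : ∀ {m} → Fin a1 → Fin m → Formula k a0 a1 m
  neg   : ∀ {m} → Formula k a0 a1 m → Formula k a0 a1 m
  and   : ∀ {m} → Formula k a0 a1 m → Formula k a0 a1 m → Formula k a0 a1 m
  or    : ∀ {m} → Formula k a0 a1 m → Formula k a0 a1 m → Formula k a0 a1 m
  ex    : ∀ {m} → Formula k a0 a1 (suc m) → Formula k a0 a1 m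

data QuantifierFree {k a0 a1 : ℕ} : ∀ {m} → Formula k a0 a1 m → Set where
  qf-w   : ∀ {m} σ (x : Fin m) → QuantifierFree (wAtom σ x)
  qf-leq : ∀ {m} (x y : Fin m) → QuantifierFree (leq x y)
  qf-nul : ∀ {m} j → QuantifierFree {m = m} (nul j)
  qf-una : ∀ {m} j (x : Fin m) → QuantifierFree (una j x)
  qf-neg : ∀ {m} {φ : Formula k a0 a1 m} → QuantifierFree φ → QuantifierFree (neg φ)
  qf-and : ∀ {m} {φ ψ : Formula k a0 a1 m} → QuantifierFree φ → QuantifierFree ψ → QuantifierFree (and φ ψ)
  qf-or  : ∀ {m} {φ ψ : Formula k a0 a1 m} → QuantifierFree φ → QuantifierFree ψ → QuantifierFree (or φ ψ)

data PositiveBody {k a0 a1 : ℕ} : ∀ {m} → Formula k a0 a1 m → Set where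
  pb-w    : ∀ {m} σ (x : Fin m) → PositiveBody (wAtom σ x)
  pb-leq  : ∀ {m} (x y : Fin m) → PositiveBody (leq x y)
  pb-nleq : ∀ {m} (x y : Fin m) → PositiveBody (neg (leq x y))
  pb-nul  : ∀ {m} j → PositiveBody {m = m} (nul j)
  pb-una  : ∀ {m} j (x : Fin m) → PositiveBody (una j x)
  pb-and  : ∀ {m} {φ ψ : Formula k a0 a1 m} → PositiveBody φ → PositiveBody ψ → PositiveBody (and φ ψ)
  pb-or   : ∀ {m} {φ ψ : Formula k a0 a1 m} → PositiveBody φ → PositiveBody ψ → PositiveBody (or φ ψ)

data Sigma1Plus {k a0 a1 : ℕ} : ∀ {m} → Formula k a0 a1 m → Set where
  s-body : ∀ {m} {φ : Formula k a0 a1 m} → PositiveBody φ → Sigma1Plus φ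
  s-ex   : ∀ {m} {φ : Formula k a0 a1 (suc m)} → Sigma1Plus φ → Sigma1Plus (ex φ)

WordEnc : ℕ → ℕ → Set
WordEnc k n = Fin n → Maybe (Fin k)

record Structure (k a0 a1 n : ℕ) : Set where
  field
    word : WordEnc k n
    aux0 : Fin a0 → Bool
    aux1 : Fin a1 → Fin n → Bool
open Structure public

isSym : ∀ {k} → Maybe (Fin k) → Fin k → Bool
isSym nothing  σ = false
isSym (just τ) σ = ⌊ τ ≟ σ ⌋

anyFin : ∀ {n} → (Fin n → Bool) → Bool
anyFin {zero}  f = false
anyFin {suc n} f = f zero ∨ anyFin (λ i → f (suc i))

extend : ∀ {n m} → Fin n → (Fin m → Fin n) → Fin (suc m) → Fin n
extend a ρ zero    = a
extend a ρ (suc x) = ρ x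

eval : ∀ {k a0 a1 n m} → Structure k a0 a1 n → Formula k a0 a1 m → (Fin m → Fin n) → Bool
eval S (wAtom σ x) ρ = isSym (word S (ρ x)) σ
eval S (leq x y)   ρ = ⌊ ρ x ≤? ρ y ⌋
eval S (nul j)     ρ = aux0 S j
eval S (una j x)   ρ = aux1 S j (ρ x)
eval S (neg φ)     ρ = not (eval S φ ρ)
eval S (and φ ψ)   ρ = eval S φ ρ ∧ eval S ψ ρ
eval S (or φ ψ)    ρ = eval S φ ρ ∨ eval S ψ ρ
eval S (ex φ)      ρ = anyFin (λ a → eval S φ (extend a ρ))

catSyms : ∀ {k} → List (Maybe (Fin k)) → List (Fin k)
catSyms [] = []
catSyms (nothing ∷ xs) = catSyms xs
catSyms (just σ ∷ xs) = σ ∷ catSyms xs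

represented : ∀ {k n} → WordEnc k n → List (Fin k)
represented {n = n} w = catSyms (map w (allFin n))

-- Dynamic programs with auxiliary relations of arity ≤ 1.
--   a0 nullary auxiliary relations, a1 unary ones, accept : the
--   distinguished 0-ary relation.
--   upd0 j σ : φ^{A_j}_σ(y)      (variable zero = y)
--   upd1 j σ : φ^{U_j}_σ(x; y)   (variable zero = x, variable one = y)
--   init0/init1 : first-order formulas over the input vocabulary only
--   (no auxiliary relations), defining the initial auxiliary relations
--   on the initial structure (word ε^n).

record DynProg (k : ℕ) : Set where
  field
    a0 a1  : ℕ
    accept : Fin a0
    upd0   : Fin a0 → Maybe (Fin k) → Formula k a0 a1 1
    upd1   : Fin a1 → Maybe (Fin k) → Formula k a0 a1 2
    init0  : Fin a0 → Formula k 0 0 0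
    init1  : Fin a1 → Formula k 0 0 1
open DynProg public

emptyWord : ∀ {k n} → WordEnc k n
emptyWord _ = nothing

noVars : ∀ {n} → Fin 0 → Fin n
noVars ()

initStruct : ∀ {k} (P : DynProg k) (n : ℕ) → Structure k (a0 P) (a1 P) n
initStruct P n = record
  { word = emptyWord
  ; aux0 = λ j → eval S₀ (init0 P j) noVars
  ; aux1 = λ j a → eval S₀ (init1 P j) (λ _ → a)
  }
  where
  S₀ : Structure _ 0 0 n
  S₀ = record { word = emptyWord ; aux0 = λ () ; aux1 = λ () }

Change : ℕ → ℕ → Set
Change k n = Maybe (Fin k) × Fin n

setWord : ∀ {k n} → WordEnc k n → Change k n → WordEnc k n
setWord w (σ , i) j with j ≟ i
... | yes _ = σ
... | no  _ = w j

step : ∀ {k n} (P : DynProg k) → Structure k (a0 P) (a1 P) n → Change k n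
     → Structure k (a0 P) (a1 P) n
step P S (σ , i) = record
  { word = w'
  ; aux0 = λ j → eval S' (upd0 P j σ) (λ _ → i)
  ; aux1 = λ j a → eval S' (upd1 P j σ) (extend a (λ _ → i))
  }
  where
  w' = setWord (word S) (σ , i)
  S' : Structure _ _ _ _
  S' = record { word = w' ; aux0 = aux0 S ; aux1 = aux1 S }

run : ∀ {k} (P : DynProg k) (n : ℕ) → List (Change k n) → Structure k (a0 P) (a1 P) n
run P n cs = foldl (step P) (initStruct P n) cs

Maintains : ∀ {k} → DynProg k → (List (Fin k) → Set) → Set
Maintains P L = ∀ (n : ℕ) (cs : List (Change _ n)) →
  (aux0 (run P n cs) (accept P) ≡ true) ⇔ L (represented (word (run P n cs)))

data DynClass : Set where
  UDynProp UDynΣ₁⁺ : DynClass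

UpdateOK : DynClass → ∀ {k a0 a1 m} → Formula k a0 a1 m → Set
UpdateOK UDynProp φ = QuantifierFree φ
UpdateOK UDynΣ₁⁺  φ = Sigma1Plus φ

InClass : ∀ {k} → DynClass → DynProg k → Set
InClass D P = (∀ j σ → UpdateOK D (upd0 P j σ)) × (∀ j σ → UpdateOK D (upd1 P j σ))

MemberIn : ∀ {k} → DynClass → (List (Fin k) → Set) → Set
MemberIn {k} D L = Σ (DynProg k) λ P → InClass D P × Maintains P L

preimage : ∀ {g k} → (Fin g → List (Fin k)) → (List (Fin k) → Set) → List (Fin g) → Set
preimage h L w = L (concatMap h w)

rightQuot : ∀ {k} → (List (Fin k) → Set) → Fin k → List (Fin k) → Set
rightQuot L σ w = L (w ++ (σ ∷ []))

leftQuot : ∀ {k} → (List (Fin k) → Set) → Fin k → List (Fin k) → Set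
leftQuot L σ w = L (σ ∷ w)

-- Each reduction replaces every position a of the new word w by a block of c positions of a word
-- over Σ whose content depends only on the letter w a and on whether a is the first, or the last,
-- position: for h⁻¹(L) the block of γ is h(γ) padded with ε, for σ⁻¹L and Lσ⁻¹ it holds the letter
-- and, at the first respectively last position, σ. A program for Member(L) is run on the block
-- word. Each of its unary relations U becomes unary relations U_r with U_r(a) ⇔ U(⟨a, r⟩), one per
-- slot r, next to relations recording the letters and the end. A change at y is the sequence of c
-- changes filling block y; composing the update formulas along it, with every atom about a block
-- position read through the stored relations, gives update formulas of the same class, since a
-- quantifier over block positions becomes ∃ followed by a disjunction over the slots (Σ₁⁺ formulas
-- are then put back into prenex form). Initially the block word is blank outside the end block, so
-- the initial relations are again first-order definable; the empty domain, which holds no block,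
-- gets the constant answer for the image of the empty word.

module Submission where

open import Defs
open import Data.Nat as ℕ using (ℕ; zero; suc; _+_; _*_)
open import Data.Fin as Fin using (Fin; zero; suc; _↑ˡ_; _↑ʳ_; combine; _≟_; _≤?_)
open import Data.List as List using (List; []; _∷_; _++_; length; concat; concatMap; fromMaybe; tabulate; allFin)
open import Data.List.Extrema.Nat using (max; xs≤max)
import Data.List.Relation.Unary.All as All
import Data.List.Properties as ListP
open import Data.Bool.ListAction using (any)
open import Data.List.Membership.Propositional using (_∈_)
open import Data.List.Membership.Propositional.Properties using (∈-allFin; ∈-map⁺)
open import Data.List.Relation.Unary.Any using (here; there)
open import Data.Maybe using (Maybe; just; nothing; maybe′)
import Data.Maybe.Properties as MaybeP
open import Data.Bool using (Bool; true; false; _∧_; _∨_; not; if_then_else_)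
open import Data.Bool.Properties
  using (∧-distribʳ-∨; ∨-zeroʳ; ∨-identityʳ; ∧-zeroʳ; ∧-identityʳ; ∨-comm; ∧-comm; ∨-assoc; not-involutive; if-eta; if-float)
open import Data.Fin.Properties as FinP using ()
open import Data.Product using (Σ; _×_; _,_; proj₁; proj₂; map₁; uncurry)
open import Data.Sum using (_⊎_; inj₁; inj₂)
open import Data.Vec.Functional using () renaming (_∷_ to _◂_)
import Data.Nat.Properties as ℕP
open import Function.Bundles using (_⇔_; mk⇔)
open import Relation.Nullary using (Dec; ¬_; contradiction)
open import Relation.Nullary.Decidable
  using (⌊_⌋; yes; no; ¬?; isYes≗does; does-⇔; dec-true; dec-false; ⌊⌋-map′)
open import Relation.Binary.Definitions using (DecidableEquality)
open import Relation.Binary.PropositionalEquality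
open import Function using (_∘_; id)

-- Finite disjunctions

anyFin-cong : ∀ {n} {f f′ : Fin n → Bool} → f ≗ f′ → anyFin f ≡ anyFin f′
anyFin-cong {zero}  f≗f′ = refl
anyFin-cong {suc n} f≗f′ = cong₂ _∨_ (f≗f′ zero) (anyFin-cong (f≗f′ ∘ suc))

anyFin-false : ∀ n → anyFin {n} (λ _ → false) ≡ false
anyFin-false zero    = refl
anyFin-false (suc n) = anyFin-false n

anyFin-tabulate : ∀ {n} {A : Set} (p : A → Bool) (f : Fin n → A) → anyFin (p ∘ f) ≡ any p (tabulate f)
anyFin-tabulate {zero}  p f = refl
anyFin-tabulate {suc n} p f = cong (p (f zero) ∨_) (anyFin-tabulate p (f ∘ suc))

anyFin≡any : ∀ {n} (p : Fin n → Bool) → anyFin p ≡ any p (allFin n)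
anyFin≡any p = anyFin-tabulate p id

anyFin-↑ : ∀ m n (f : Fin (m + n) → Bool) →
           anyFin f ≡ anyFin (f ∘ (_↑ˡ n)) ∨ anyFin (f ∘ (m ↑ʳ_))
anyFin-↑ zero    n f = refl
anyFin-↑ (suc m) n f =
  trans (cong (f zero ∨_) (anyFin-↑ m n (f ∘ suc))) (sym (∨-assoc (f zero) _ _))

anyFin-combine : ∀ m n (f : Fin (m * n) → Bool) →
                 anyFin f ≡ anyFin {m} (λ a → anyFin {n} (λ r → f (combine a r)))
anyFin-combine zero    n f = refl
anyFin-combine (suc m) n f =
  trans (anyFin-↑ n (m * n) f) (cong (anyFin (f ∘ (_↑ˡ m * n)) ∨_) (anyFin-combine m n (f ∘ (n ↑ʳ_))))

anyFin-witness : ∀ {n} (f : Fin n → Bool) i → f i ≡ true → anyFin f ≡ true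
anyFin-witness f zero    fi = cong (_∨ anyFin (f ∘ suc)) fi
anyFin-witness f (suc i) fi = trans (cong (f zero ∨_) (anyFin-witness (f ∘ suc) i fi)) (∨-zeroʳ (f zero))

anyFin-none : ∀ {n} (f : Fin n → Bool) → (∀ i → f i ≡ false) → anyFin f ≡ false
anyFin-none {n} f none = trans (anyFin-cong none) (anyFin-false n)

⌊⌋-true : ∀ {A : Set} (a? : Dec A) → A → ⌊ a? ⌋ ≡ true
⌊⌋-true a? a = trans (isYes≗does a?) (dec-true a? a)

⌊⌋-false : ∀ {A : Set} (a? : Dec A) → ¬ A → ⌊ a? ⌋ ≡ false
⌊⌋-false a? ¬a = trans (isYes≗does a?) (dec-false a? ¬a)

⌊⌋-⇔ : ∀ {A B : Set} (a? : Dec A) (b? : Dec B) → A ⇔ B → ⌊ a? ⌋ ≡ ⌊ b? ⌋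
⌊⌋-⇔ a? b? A⇔B = trans (isYes≗does a?) (trans (does-⇔ A⇔B a? b?) (sym (isYes≗does b?)))

⌊¬?⌋ : ∀ {A : Set} (a? : Dec A) → ⌊ ¬? a? ⌋ ≡ not ⌊ a? ⌋
⌊¬?⌋ (yes _) = refl
⌊¬?⌋ (no _)  = refl

∨-select : ∀ b x y → (b ∧ x) ∨ (not b ∧ y) ≡ (if b then x else y)
∨-select true  x y = ∨-identityʳ x
∨-select false x y = refl

if-true-false : ∀ {A : Set} b (f : Bool → A) → (if b then f true else f false) ≡ f b
if-true-false true  f = refl
if-true-false false f = refl

any-cong : ∀ {A : Set} {p q : A → Bool} → p ≗ q → ∀ xs → any p xs ≡ any q xs
any-cong p≗q []       = refl
any-cong p≗q (x ∷ xs) = cong₂ _∨_ (p≗q x) (any-cong p≗q xs)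

any-∧ʳ : ∀ {A : Set} (p : A → Bool) b xs → any (λ x → p x ∧ b) xs ≡ any p xs ∧ b
any-∧ʳ p b []       = refl
any-∧ʳ p b (x ∷ xs) =
  trans (cong (p x ∧ b ∨_) (any-∧ʳ p b xs)) (sym (∧-distribʳ-∨ b (p x) (any p xs)))

module _ {A : Set} (_≟_ : DecidableEquality A) where

  ⌊≟⌋-sym : ∀ x y → ⌊ x ≟ y ⌋ ≡ ⌊ y ≟ x ⌋
  ⌊≟⌋-sym x y = ⌊⌋-⇔ (x ≟ y) (y ≟ x) (mk⇔ sym sym)

  any-≟ : ∀ {x xs} → x ∈ xs → any (λ x′ → ⌊ x′ ≟ x ⌋) xs ≡ true
  any-≟ {x} {_ ∷ xs} (here refl) = cong (_∨ any (λ x′ → ⌊ x′ ≟ x ⌋) xs) (⌊⌋-true (x ≟ x) refl)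
  any-≟ {x} {x′ ∷ _} (there x∈xs) = trans (cong (⌊ x′ ≟ x ⌋ ∨_) (any-≟ x∈xs)) (∨-zeroʳ _)

  any-select : ∀ {x xs} → x ∈ xs → (f : A → Bool) → any (λ x′ → ⌊ x′ ≟ x ⌋ ∧ f x′) xs ≡ f x
  any-select {x} {xs} x∈xs f = begin
    any (λ x′ → ⌊ x′ ≟ x ⌋ ∧ f x′) xs ≡⟨ any-cong selected xs ⟩
    any (λ x′ → ⌊ x′ ≟ x ⌋ ∧ f x) xs  ≡⟨ any-∧ʳ _ (f x) xs ⟩
    any (λ x′ → ⌊ x′ ≟ x ⌋) xs ∧ f x  ≡⟨ cong (_∧ f x) (any-≟ x∈xs) ⟩
    f x                               ∎
    where
    open ≡-Reasoning
    selected : ∀ x′ → ⌊ x′ ≟ x ⌋ ∧ f x′ ≡ ⌊ x′ ≟ x ⌋ ∧ f x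
    selected x′ with x′ ≟ x
    ... | yes refl = refl
    ... | no _     = refl

≤?-antisym : ∀ {n} (x y : Fin n) → ⌊ x ≤? y ⌋ ∧ ⌊ y ≤? x ⌋ ≡ ⌊ x ≟ y ⌋
≤?-antisym x y with x ≤? y | y ≤? x | x ≟ y
... | yes x≤y | yes y≤x | no x≢y  = contradiction (FinP.≤-antisym x≤y y≤x) x≢y
... | yes _   | no y≰x  | yes refl = contradiction FinP.≤-refl y≰x
... | no x≰y  | _       | yes refl = contradiction FinP.≤-refl x≰y
... | yes _   | yes _   | yes _    = refl
... | yes _   | no _    | no _     = refl
... | no _    | _       | no _     = refl

-- Formulas

module _ {k a0 a1 : ℕ} where

  eval-cong : ∀ {n m} (S : Structure k a0 a1 n) (φ : Formula k a0 a1 m) {ρ ρ′ : Fin m → Fin n} →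
              ρ ≗ ρ′ → eval S φ ρ ≡ eval S φ ρ′
  eval-cong S (wAtom σ x) ρ≗ρ′ = cong (λ a → isSym (word S a) σ) (ρ≗ρ′ x)
  eval-cong S (leq x y)   ρ≗ρ′ = cong₂ (λ a b → ⌊ a ≤? b ⌋) (ρ≗ρ′ x) (ρ≗ρ′ y)
  eval-cong S (nul j)     ρ≗ρ′ = refl
  eval-cong S (una j x)   ρ≗ρ′ = cong (aux1 S j) (ρ≗ρ′ x)
  eval-cong S (neg φ)     ρ≗ρ′ = cong not (eval-cong S φ ρ≗ρ′)
  eval-cong S (and φ ψ)   ρ≗ρ′ = cong₂ _∧_ (eval-cong S φ ρ≗ρ′) (eval-cong S ψ ρ≗ρ′)
  eval-cong S (or φ ψ)    ρ≗ρ′ = cong₂ _∨_ (eval-cong S φ ρ≗ρ′) (eval-cong S ψ ρ≗ρ′)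
  eval-cong S (ex φ) {ρ} {ρ′} ρ≗ρ′ = anyFin-cong λ a → eval-cong S φ (extend-cong a)
    where
    extend-cong : ∀ a x → extend a ρ x ≡ extend a ρ′ x
    extend-cong a zero    = refl
    extend-cong a (suc x) = ρ≗ρ′ x

  rename : ∀ {m m′} → (Fin m → Fin m′) → Formula k a0 a1 m → Formula k a0 a1 m′
  rename f (wAtom σ x) = wAtom σ (f x)
  rename f (leq x y)   = leq (f x) (f y)
  rename f (nul j)     = nul j
  rename f (una j x)   = una j (f x)
  rename f (neg φ)     = neg (rename f φ)
  rename f (and φ ψ)   = and (rename f φ) (rename f ψ)
  rename f (or φ ψ)    = or (rename f φ) (rename f ψ)
  rename f (ex φ)      = ex (rename (Fin.lift 1 f) φ)

  eval-rename : ∀ {n m m′} (S : Structure k a0 a1 n) (f : Fin m → Fin m′) (φ : Formula k a0 a1 m) ρ →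
                eval S (rename f φ) ρ ≡ eval S φ (ρ ∘ f)
  eval-rename S f (wAtom σ x) ρ = refl
  eval-rename S f (leq x y)   ρ = refl
  eval-rename S f (nul j)     ρ = refl
  eval-rename S f (una j x)   ρ = refl
  eval-rename S f (neg φ)     ρ = cong not (eval-rename S f φ ρ)
  eval-rename S f (and φ ψ)   ρ = cong₂ _∧_ (eval-rename S f φ ρ) (eval-rename S f ψ ρ)
  eval-rename S f (or φ ψ)    ρ = cong₂ _∨_ (eval-rename S f φ ρ) (eval-rename S f ψ ρ)
  eval-rename S f (ex φ)      ρ = anyFin-cong λ a →
    trans (eval-rename S (Fin.lift 1 f) φ (extend a ρ)) (eval-cong S φ (extend-lift a))
    where
    extend-lift : ∀ a x → extend a ρ (Fin.lift 1 f x) ≡ extend a (ρ ∘ f) x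
    extend-lift a zero    = refl
    extend-lift a (suc x) = refl

  negF : ∀ {m} → Formula k a0 a1 m → Formula k a0 a1 m
  negF (neg φ) = φ
  negF φ       = neg φ

  eval-negF : ∀ {n m} (S : Structure k a0 a1 n) (φ : Formula k a0 a1 m) ρ →
              eval S (negF φ) ρ ≡ not (eval S φ ρ)
  eval-negF S (wAtom σ x) ρ = refl
  eval-negF S (leq x y)   ρ = refl
  eval-negF S (nul j)     ρ = refl
  eval-negF S (una j x)   ρ = refl
  eval-negF S (neg φ)     ρ = sym (not-involutive _)
  eval-negF S (and φ ψ)   ρ = refl
  eval-negF S (or φ ψ)    ρ = refl
  eval-negF S (ex φ)      ρ = refl

  -- A variable is needed to express the constants without quantifiers.
  constF : ∀ {m} → Bool → Fin m → Formula k a0 a1 m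
  constF true  v = leq v v
  constF false v = neg (leq v v)

  eval-constF : ∀ {n m} (S : Structure k a0 a1 n) b (v : Fin m) ρ → eval S (constF b v) ρ ≡ b
  eval-constF S true  v ρ = ≤?-refl (ρ v)
    where
    ≤?-refl : ∀ {n} (a : Fin n) → ⌊ a ≤? a ⌋ ≡ true
    ≤?-refl a with a ≤? a
    ... | yes _   = refl
    ... | no a≰a = contradiction FinP.≤-refl a≰a
  eval-constF S false v ρ = cong not (eval-constF S true v ρ)

  eqF neqF : ∀ {m} → Fin m → Fin m → Formula k a0 a1 m
  eqF  v u = and (leq v u) (leq u v)
  neqF v u = or (neg (leq v u)) (neg (leq u v))

  eval-eqF : ∀ {n m} (S : Structure k a0 a1 n) (v u : Fin m) ρ → eval S (eqF v u) ρ ≡ ⌊ ρ v ≟ ρ u ⌋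
  eval-eqF S v u ρ = ≤?-antisym (ρ v) (ρ u)

  eval-neqF : ∀ {n m} (S : Structure k a0 a1 n) (v u : Fin m) ρ → eval S (neqF v u) ρ ≡ not ⌊ ρ v ≟ ρ u ⌋
  eval-neqF S v u ρ = trans (deMorgan ⌊ ρ v ≤? ρ u ⌋ _) (cong not (≤?-antisym (ρ v) (ρ u)))
    where
    deMorgan : ∀ x y → not x ∨ not y ≡ not (x ∧ y)
    deMorgan true  y = refl
    deMorgan false y = refl

  bigOr : ∀ {m} {A : Set} → Fin m → List A → (A → Formula k a0 a1 m) → Formula k a0 a1 m
  bigOr v []       φ = constF false v
  bigOr v (x ∷ xs) φ = or (φ x) (bigOr v xs φ)

  eval-bigOr : ∀ {n m} {A : Set} (S : Structure k a0 a1 n) (v : Fin m) xs (φ : A → Formula k a0 a1 m) ρ →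
               eval S (bigOr v xs φ) ρ ≡ any (λ x → eval S (φ x) ρ) xs
  eval-bigOr S v []       φ ρ = eval-constF S false v ρ
  eval-bigOr S v (x ∷ xs) φ ρ = cong (eval S (φ x) ρ ∨_) (eval-bigOr S v xs φ ρ)

  -- The formulas that normalize turns into an equivalent update formula of class D; for UDynΣ₁⁺
  -- these are the positive existential formulas, whose quantifiers need not be in front.
  data Admissible : DynClass → ∀ {m} → Formula k a0 a1 m → Set where
    adm-wAtom : ∀ {D m} σ (x : Fin m) → Admissible D (wAtom σ x)
    adm-leq   : ∀ {D m} (x y : Fin m) → Admissible D (leq x y)
    adm-nleq  : ∀ {D m} (x y : Fin m) → Admissible D (neg (leq x y))
    adm-nul   : ∀ {D m} j → Admissible D {m} (nul j)
    adm-una   : ∀ {D m} j (x : Fin m) → Admissible D (una j x)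
    adm-and   : ∀ {D m} {φ ψ : Formula k a0 a1 m} → Admissible D φ → Admissible D ψ → Admissible D (and φ ψ)
    adm-or    : ∀ {D m} {φ ψ : Formula k a0 a1 m} → Admissible D φ → Admissible D ψ → Admissible D (or φ ψ)
    adm-neg   : ∀ {m} {φ : Formula k a0 a1 m} → Admissible UDynProp φ → Admissible UDynProp (neg φ)
    adm-ex    : ∀ {m} {φ : Formula k a0 a1 (suc m)} → Admissible UDynΣ₁⁺ φ → Admissible UDynΣ₁⁺ (ex φ)

  updateOK⇒admissible : ∀ D {m} {φ : Formula k a0 a1 m} → UpdateOK D φ → Admissible D φ
  updateOK⇒admissible UDynProp = quantifierFree⇒admissible
    where
    quantifierFree⇒admissible : ∀ {m} {φ : Formula k a0 a1 m} → QuantifierFree φ → Admissible UDynProp φ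
    quantifierFree⇒admissible (qf-w σ x)   = adm-wAtom σ x
    quantifierFree⇒admissible (qf-leq x y) = adm-leq x y
    quantifierFree⇒admissible (qf-nul j)   = adm-nul j
    quantifierFree⇒admissible (qf-una j x) = adm-una j x
    quantifierFree⇒admissible (qf-neg p)   = adm-neg (quantifierFree⇒admissible p)
    quantifierFree⇒admissible (qf-and p q) = adm-and (quantifierFree⇒admissible p) (quantifierFree⇒admissible q)
    quantifierFree⇒admissible (qf-or p q)  = adm-or (quantifierFree⇒admissible p) (quantifierFree⇒admissible q)
  updateOK⇒admissible UDynΣ₁⁺ = sigma1Plus⇒admissible
    where
    positiveBody⇒admissible : ∀ {m} {φ : Formula k a0 a1 m} → PositiveBody φ → Admissible UDynΣ₁⁺ φ
    positiveBody⇒admissible (pb-w σ x)    = adm-wAtom σ x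
    positiveBody⇒admissible (pb-leq x y)  = adm-leq x y
    positiveBody⇒admissible (pb-nleq x y) = adm-nleq x y
    positiveBody⇒admissible (pb-nul j)    = adm-nul j
    positiveBody⇒admissible (pb-una j x)  = adm-una j x
    positiveBody⇒admissible (pb-and p q)  = adm-and (positiveBody⇒admissible p) (positiveBody⇒admissible q)
    positiveBody⇒admissible (pb-or p q)   = adm-or (positiveBody⇒admissible p) (positiveBody⇒admissible q)
    sigma1Plus⇒admissible : ∀ {m} {φ : Formula k a0 a1 m} → Sigma1Plus φ → Admissible UDynΣ₁⁺ φ
    sigma1Plus⇒admissible (s-body p) = positiveBody⇒admissible p
    sigma1Plus⇒admissible (s-ex p)   = adm-ex (sigma1Plus⇒admissible p)

  admissible-negF : ∀ {m} {φ : Formula k a0 a1 m} → Admissible UDynProp φ → Admissible UDynProp (negF φ)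
  admissible-negF (adm-wAtom σ x) = adm-neg (adm-wAtom σ x)
  admissible-negF (adm-leq x y)   = adm-nleq x y
  admissible-negF (adm-nleq x y)  = adm-leq x y
  admissible-negF (adm-nul j)     = adm-neg (adm-nul j)
  admissible-negF (adm-una j x)   = adm-neg (adm-una j x)
  admissible-negF (adm-and p q)   = adm-neg (adm-and p q)
  admissible-negF (adm-or p q)    = adm-neg (adm-or p q)
  admissible-negF (adm-neg p)     = p

  admissible-constF : ∀ {D m} b (v : Fin m) → Admissible D (constF b v)
  admissible-constF true  v = adm-leq v v
  admissible-constF false v = adm-nleq v v

  admissible-eqF : ∀ {D m} (v u : Fin m) → Admissible D (eqF v u)
  admissible-eqF v u = adm-and (adm-leq v u) (adm-leq u v)

  admissible-neqF : ∀ {D m} (v u : Fin m) → Admissible D (neqF v u)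
  admissible-neqF v u = adm-or (adm-nleq v u) (adm-nleq u v)

  admissible-bigOr : ∀ {D m} {A : Set} (v : Fin m) xs {φ : A → Formula k a0 a1 m} →
                     (∀ x → Admissible D (φ x)) → Admissible D (bigOr v xs φ)
  admissible-bigOr v []       p = admissible-constF false v
  admissible-bigOr v (x ∷ xs) p = adm-or (p x) (admissible-bigOr v xs p)

  pb-rename : ∀ {m m′} (f : Fin m → Fin m′) {φ : Formula k a0 a1 m} →
              PositiveBody φ → PositiveBody (rename f φ)
  pb-rename f (pb-w σ x)    = pb-w σ (f x)
  pb-rename f (pb-leq x y)  = pb-leq (f x) (f y)
  pb-rename f (pb-nleq x y) = pb-nleq (f x) (f y)
  pb-rename f (pb-nul j)    = pb-nul j
  pb-rename f (pb-una j x)  = pb-una j (f x)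
  pb-rename f (pb-and p q)  = pb-and (pb-rename f p) (pb-rename f q)
  pb-rename f (pb-or p q)   = pb-or (pb-rename f p) (pb-rename f q)

  data Connective : Set where
    conj disj : Connective

  connect : ∀ {m} → Connective → Formula k a0 a1 m → Formula k a0 a1 m → Formula k a0 a1 m
  connect conj = and
  connect disj = or

  ⟦_⟧ᶜ : Connective → Bool → Bool → Bool
  ⟦ conj ⟧ᶜ = _∧_
  ⟦ disj ⟧ᶜ = _∨_

  eval-connect : ∀ {n m} (S : Structure k a0 a1 n) c (φ ψ : Formula k a0 a1 m) ρ →
                 eval S (connect c φ ψ) ρ ≡ ⟦ c ⟧ᶜ (eval S φ ρ) (eval S ψ ρ)
  eval-connect S conj φ ψ ρ = refl
  eval-connect S disj φ ψ ρ = refl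

  pb-connect : ∀ {m} c {φ ψ : Formula k a0 a1 m} →
               PositiveBody φ → PositiveBody ψ → PositiveBody (connect c φ ψ)
  pb-connect conj = pb-and
  pb-connect disj = pb-or

  -- ∃ commutes with ∨ only over a nonempty domain.
  anyFin-connectˡ : ∀ {n} c b (f : Fin (suc n) → Bool) →
                    anyFin (λ a → ⟦ c ⟧ᶜ b (f a)) ≡ ⟦ c ⟧ᶜ b (anyFin f)
  anyFin-connectˡ conj true  f = refl
  anyFin-connectˡ {n} conj false f = anyFin-false (suc n)
  anyFin-connectˡ disj true  f = refl
  anyFin-connectˡ disj false f = refl

  anyFin-connectʳ : ∀ {n} c (f : Fin (suc n) → Bool) b →
                    anyFin (λ a → ⟦ c ⟧ᶜ (f a) b) ≡ ⟦ c ⟧ᶜ (anyFin f) b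
  anyFin-connectʳ c f b = begin
    anyFin (λ a → ⟦ c ⟧ᶜ (f a) b) ≡⟨ anyFin-cong (λ a → comm c (f a) b) ⟩
    anyFin (λ a → ⟦ c ⟧ᶜ b (f a)) ≡⟨ anyFin-connectˡ c b f ⟩
    ⟦ c ⟧ᶜ b (anyFin f)           ≡⟨ comm c b (anyFin f) ⟩
    ⟦ c ⟧ᶜ (anyFin f) b           ∎
    where
    open ≡-Reasoning
    comm : ∀ c x y → ⟦ c ⟧ᶜ x y ≡ ⟦ c ⟧ᶜ y x
    comm conj = ∧-comm
    comm disj = ∨-comm

  data Prenex : ℕ → Set where
    body : ∀ {m} (φ : Formula k a0 a1 m) → PositiveBody φ → Prenex m
    ∃′_  : ∀ {m} → Prenex (suc m) → Prenex m

  ⌜_⌝ : ∀ {m} → Prenex m → Formula k a0 a1 m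
  ⌜ body φ _ ⌝ = φ
  ⌜ ∃′ p ⌝     = ex ⌜ p ⌝

  sigma1Plus-⌜⌝ : ∀ {m} (p : Prenex m) → Sigma1Plus ⌜ p ⌝
  sigma1Plus-⌜⌝ (body φ pb) = s-body pb
  sigma1Plus-⌜⌝ (∃′ p)      = s-ex (sigma1Plus-⌜⌝ p)

  renameᵖ : ∀ {m m′} → (Fin m → Fin m′) → Prenex m → Prenex m′
  renameᵖ f (body φ pb) = body (rename f φ) (pb-rename f pb)
  renameᵖ f (∃′ p)      = ∃′ renameᵖ (Fin.lift 1 f) p

  ⌜⌝-renameᵖ : ∀ {m m′} (f : Fin m → Fin m′) (p : Prenex m) → ⌜ renameᵖ f p ⌝ ≡ rename f ⌜ p ⌝
  ⌜⌝-renameᵖ f (body φ pb) = refl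
  ⌜⌝-renameᵖ f (∃′ p)      = cong ex (⌜⌝-renameᵖ (Fin.lift 1 f) p)

  connectᵇ : ∀ {m} → Connective → (φ : Formula k a0 a1 m) → PositiveBody φ → Prenex m → Prenex m
  connectᵇ c φ pb (body ψ qb) = body (connect c φ ψ) (pb-connect c pb qb)
  connectᵇ c φ pb (∃′ q)      = ∃′ connectᵇ c (rename suc φ) (pb-rename suc pb) q

  connectᵖ : ∀ {m} → Connective → Prenex m → Prenex m → Prenex m
  connectᵖ c (body φ pb) q = connectᵇ c φ pb q
  connectᵖ c (∃′ p)      q = ∃′ connectᵖ c p (renameᵖ suc q)

  module _ {n : ℕ} (S : Structure k a0 a1 (suc n)) where

    eval-weaken : ∀ {m} (φ : Formula k a0 a1 m) a ρ → eval S (rename suc φ) (extend a ρ) ≡ eval S φ ρ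
    eval-weaken φ a ρ = eval-rename S suc φ (extend a ρ)

    eval-weakenᵖ : ∀ {m} (p : Prenex m) a ρ → eval S ⌜ renameᵖ suc p ⌝ (extend a ρ) ≡ eval S ⌜ p ⌝ ρ
    eval-weakenᵖ p a ρ = trans (cong (λ φ → eval S φ (extend a ρ)) (⌜⌝-renameᵖ suc p)) (eval-weaken ⌜ p ⌝ a ρ)

    eval-connectᵇ : ∀ {m} c (φ : Formula k a0 a1 m) pb q ρ →
                    eval S ⌜ connectᵇ c φ pb q ⌝ ρ ≡ ⟦ c ⟧ᶜ (eval S φ ρ) (eval S ⌜ q ⌝ ρ)
    eval-connectᵇ c φ pb (body ψ qb) ρ = eval-connect S c φ ψ ρ
    eval-connectᵇ c φ pb (∃′ q)      ρ = begin
      anyFin (λ a → eval S ⌜ connectᵇ c (rename suc φ) (pb-rename suc pb) q ⌝ (extend a ρ))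
        ≡⟨ anyFin-cong (λ a → eval-connectᵇ c (rename suc φ) (pb-rename suc pb) q (extend a ρ)) ⟩
      anyFin (λ a → ⟦ c ⟧ᶜ (eval S (rename suc φ) (extend a ρ)) (eval S ⌜ q ⌝ (extend a ρ)))
        ≡⟨ anyFin-cong (λ a → cong (λ b → ⟦ c ⟧ᶜ b (eval S ⌜ q ⌝ (extend a ρ))) (eval-weaken φ a ρ)) ⟩
      anyFin (λ a → ⟦ c ⟧ᶜ (eval S φ ρ) (eval S ⌜ q ⌝ (extend a ρ)))
        ≡⟨ anyFin-connectˡ c (eval S φ ρ) (λ a → eval S ⌜ q ⌝ (extend a ρ)) ⟩
      ⟦ c ⟧ᶜ (eval S φ ρ) (eval S ⌜ ∃′ q ⌝ ρ) ∎
      where open ≡-Reasoning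

    eval-connectᵖ : ∀ {m} c (p q : Prenex m) ρ →
                    eval S ⌜ connectᵖ c p q ⌝ ρ ≡ ⟦ c ⟧ᶜ (eval S ⌜ p ⌝ ρ) (eval S ⌜ q ⌝ ρ)
    eval-connectᵖ c (body φ pb) q ρ = eval-connectᵇ c φ pb q ρ
    eval-connectᵖ c (∃′ p)      q ρ = begin
      anyFin (λ a → eval S ⌜ connectᵖ c p (renameᵖ suc q) ⌝ (extend a ρ))
        ≡⟨ anyFin-cong (λ a → eval-connectᵖ c p (renameᵖ suc q) (extend a ρ)) ⟩
      anyFin (λ a → ⟦ c ⟧ᶜ (eval S ⌜ p ⌝ (extend a ρ)) (eval S ⌜ renameᵖ suc q ⌝ (extend a ρ)))
        ≡⟨ anyFin-cong (λ a → cong (⟦ c ⟧ᶜ (eval S ⌜ p ⌝ (extend a ρ))) (eval-weakenᵖ q a ρ)) ⟩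
      anyFin (λ a → ⟦ c ⟧ᶜ (eval S ⌜ p ⌝ (extend a ρ)) (eval S ⌜ q ⌝ ρ))
        ≡⟨ anyFin-connectʳ c (λ a → eval S ⌜ p ⌝ (extend a ρ)) (eval S ⌜ q ⌝ ρ) ⟩
      ⟦ c ⟧ᶜ (eval S ⌜ ∃′ p ⌝ ρ) (eval S ⌜ q ⌝ ρ) ∎
      where open ≡-Reasoning

  prenex : ∀ {m} {φ : Formula k a0 a1 m} → Admissible UDynΣ₁⁺ φ → Prenex m
  prenex (adm-wAtom σ x) = body _ (pb-w σ x)
  prenex (adm-leq x y)   = body _ (pb-leq x y)
  prenex (adm-nleq x y)  = body _ (pb-nleq x y)
  prenex (adm-nul j)     = body _ (pb-nul j)
  prenex (adm-una j x)   = body _ (pb-una j x)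
  prenex (adm-and p q)   = connectᵖ conj (prenex p) (prenex q)
  prenex (adm-or p q)    = connectᵖ disj (prenex p) (prenex q)
  prenex (adm-ex p)      = ∃′ prenex p

  eval-prenex : ∀ {n m} (S : Structure k a0 a1 (suc n)) {φ : Formula k a0 a1 m} (p : Admissible UDynΣ₁⁺ φ) ρ →
                eval S ⌜ prenex p ⌝ ρ ≡ eval S φ ρ
  eval-prenex S (adm-wAtom σ x) ρ = refl
  eval-prenex S (adm-leq x y)   ρ = refl
  eval-prenex S (adm-nleq x y)  ρ = refl
  eval-prenex S (adm-nul j)     ρ = refl
  eval-prenex S (adm-una j x)   ρ = refl
  eval-prenex S (adm-and p q)   ρ =
    trans (eval-connectᵖ S conj (prenex p) (prenex q) ρ) (cong₂ _∧_ (eval-prenex S p ρ) (eval-prenex S q ρ))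
  eval-prenex S (adm-or p q)    ρ =
    trans (eval-connectᵖ S disj (prenex p) (prenex q) ρ) (cong₂ _∨_ (eval-prenex S p ρ) (eval-prenex S q ρ))
  eval-prenex S (adm-ex p)      ρ = anyFin-cong λ a → eval-prenex S p (extend a ρ)

  normalize : ∀ D {m} {φ : Formula k a0 a1 m} → Admissible D φ → Formula k a0 a1 m
  normalize UDynProp {φ = φ} _ = φ
  normalize UDynΣ₁⁺ p          = ⌜ prenex p ⌝

  normalize-updateOK : ∀ D {m} {φ : Formula k a0 a1 m} (p : Admissible D φ) → UpdateOK D (normalize D p)
  normalize-updateOK UDynProp p = admissible⇒quantifierFree p
    where
    admissible⇒quantifierFree : ∀ {m} {φ : Formula k a0 a1 m} → Admissible UDynProp φ → QuantifierFree φ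
    admissible⇒quantifierFree (adm-wAtom σ x) = qf-w σ x
    admissible⇒quantifierFree (adm-leq x y)   = qf-leq x y
    admissible⇒quantifierFree (adm-nleq x y)  = qf-neg (qf-leq x y)
    admissible⇒quantifierFree (adm-nul j)     = qf-nul j
    admissible⇒quantifierFree (adm-una j x)   = qf-una j x
    admissible⇒quantifierFree (adm-and p q)   = qf-and (admissible⇒quantifierFree p) (admissible⇒quantifierFree q)
    admissible⇒quantifierFree (adm-or p q)    = qf-or (admissible⇒quantifierFree p) (admissible⇒quantifierFree q)
    admissible⇒quantifierFree (adm-neg p)     = qf-neg (admissible⇒quantifierFree p)
  normalize-updateOK UDynΣ₁⁺ p = sigma1Plus-⌜⌝ (prenex p)

  eval-normalize : ∀ D {n m} (S : Structure k a0 a1 (suc n)) {φ : Formula k a0 a1 m} (p : Admissible D φ) ρ →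
                   eval S (normalize D p) ρ ≡ eval S φ ρ
  eval-normalize UDynProp S p ρ = refl
  eval-normalize UDynΣ₁⁺ S p ρ = eval-prenex S p ρ

-- Formulas about blocks of positions

module _ {n c : ℕ} where

  combine-monoʳ-≤ : ∀ (a : Fin n) {r s : Fin c} → r Fin.≤ s → combine a r Fin.≤ combine a s
  combine-monoʳ-≤ a {r} {s} r≤s = subst₂ ℕ._≤_ (sym (FinP.toℕ-combine a r)) (sym (FinP.toℕ-combine a s))
                                          (ℕP.+-monoʳ-≤ (c * Fin.toℕ a) r≤s)

  combine-monoʳ-< : ∀ (a : Fin n) {r s : Fin c} → r Fin.< s → combine a r Fin.< combine a s
  combine-monoʳ-< a {r} {s} r<s = subst₂ ℕ._<_ (sym (FinP.toℕ-combine a r)) (sym (FinP.toℕ-combine a s))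
                                          (ℕP.+-monoʳ-< (c * Fin.toℕ a) r<s)

  combine-mono-≤ : ∀ {a b : Fin n} {r s : Fin c} → a Fin.≤ b → r Fin.≤ s → combine a r Fin.≤ combine b s
  combine-mono-≤ {a} {b} {r} {s} a≤b r≤s with ℕP.m≤n⇒m<n∨m≡n a≤b
  ... | inj₁ a<b = ℕP.<⇒≤ (FinP.combine-monoˡ-< r s a<b)
  ... | inj₂ a≡b rewrite FinP.toℕ-injective a≡b = combine-monoʳ-≤ b r≤s

  combine-mono-< : ∀ {a b : Fin n} {r s : Fin c} → a Fin.≤ b → r Fin.< s → combine a r Fin.< combine b s
  combine-mono-< {a} {b} {r} {s} a≤b r<s with ℕP.m≤n⇒m<n∨m≡n a≤b
  ... | inj₁ a<b = FinP.combine-monoˡ-< r s a<b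
  ... | inj₂ a≡b rewrite FinP.toℕ-injective a≡b = combine-monoʳ-< b r<s

  -- The order of blocks is lexicographic.
  combine-≤? : ∀ (a b : Fin n) (r s : Fin c) →
               ⌊ combine a r ≤? combine b s ⌋ ≡ (if ⌊ r ≤? s ⌋ then ⌊ a ≤? b ⌋ else not ⌊ b ≤? a ⌋)
  combine-≤? a b r s with r ≤? s
  ... | yes r≤s = ⌊⌋-⇔ (combine a r ≤? combine b s) (a ≤? b) (mk⇔ to (λ a≤b → combine-mono-≤ a≤b r≤s))
    where
    to : combine a r Fin.≤ combine b s → a Fin.≤ b
    to le = ℕP.≮⇒≥ λ b<a → ℕP.<⇒≱ (FinP.combine-monoˡ-< s r b<a) le
  ... | no r≰s = trans (⌊⌋-⇔ (combine a r ≤? combine b s) (¬? (b ≤? a)) (mk⇔ to from)) (⌊¬?⌋ (b ≤? a))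
    where
    to : combine a r Fin.≤ combine b s → ¬ b Fin.≤ a
    to le b≤a = ℕP.<⇒≱ (combine-mono-< b≤a (ℕP.≰⇒> r≰s)) le
    from : ¬ b Fin.≤ a → combine a r Fin.≤ combine b s
    from b≰a = ℕP.<⇒≤ (FinP.combine-monoˡ-< r s (ℕP.≰⇒> b≰a))

blockEnv : ∀ {n c m m′} → (Fin m′ → Fin n) → (Fin m → Fin m′ × Fin c) → Fin m → Fin (n * c)
blockEnv ν ρ = uncurry combine ∘ map₁ ν ∘ ρ

-- Formulas about a structure on n · c positions, the position ⟨a, r⟩ being combine a r, rewritten
-- as formulas on n positions. The first argument of each field is the variable holding the block
-- being changed; wordAt y τ v r stands for W_τ(⟨v, r⟩) and unary y j v r for U_j(⟨v, r⟩).
record Interpretation (k a0 a1 g b0 b1 c : ℕ) : Set where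
  field
    wordAt  : ∀ {m} → Fin m → Fin k → Fin m → Fin c → Formula g b0 b1 m
    nullary : ∀ {m} → Fin m → Fin a0 → Formula g b0 b1 m
    unary   : ∀ {m} → Fin m → Fin a1 → Fin m → Fin c → Formula g b0 b1 m

module _ {k a0 a1 g b0 b1 c : ℕ} (I : Interpretation k a0 a1 g b0 b1 c) where
  open Interpretation I

  leqᵇ : ∀ {m} → Fin m × Fin c → Fin m × Fin c → Formula g b0 b1 m
  leqᵇ (v , r) (u , s) = if ⌊ r ≤? s ⌋ then leq v u else neg (leq u v)

  translate : ∀ {m m′} → Formula k a0 a1 m → (Fin m → Fin m′ × Fin c) → Fin m′ → Formula g b0 b1 m′
  translate (wAtom τ x) ρ y = wordAt y τ (proj₁ (ρ x)) (proj₂ (ρ x))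
  translate (leq x x′)  ρ y = leqᵇ (ρ x) (ρ x′)
  translate (nul j)     ρ y = nullary y j
  translate (una j x)   ρ y = unary y j (proj₁ (ρ x)) (proj₂ (ρ x))
  translate (neg φ)     ρ y = negF (translate φ ρ y)
  translate (and φ ψ)   ρ y = and (translate φ ρ y) (translate ψ ρ y)
  translate (or φ ψ)    ρ y = or (translate φ ρ y) (translate ψ ρ y)
  translate (ex φ)      ρ y = ex (bigOr zero (allFin c) λ r → translate φ ((zero , r) ◂ (map₁ suc ∘ ρ)) (suc y))

  record AdmissibleAtoms (D : DynClass) : Set where
    field
      wordAt-admissible  : ∀ {m} y τ (v : Fin m) r → Admissible D (wordAt y τ v r)
      nullary-admissible : ∀ {m} (y : Fin m) j → Admissible D (nullary y j)
      unary-admissible   : ∀ {m} y j (v : Fin m) r → Admissible D (unary y j v r)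

  admissible-translate : ∀ {D} → AdmissibleAtoms D → ∀ {m m′} {φ : Formula k a0 a1 m} → Admissible D φ →
                         (ρ : Fin m → Fin m′ × Fin c) (y : Fin m′) → Admissible D (translate φ ρ y)
  admissible-translate {D} A = go
    where
    open AdmissibleAtoms A
    leqᵇ-admissible : ∀ {m} (p q : Fin m × Fin c) → Admissible D (leqᵇ p q) × Admissible D (negF (leqᵇ p q))
    leqᵇ-admissible (v , r) (u , s) with ⌊ r ≤? s ⌋
    ... | true  = adm-leq v u , adm-nleq v u
    ... | false = adm-nleq u v , adm-leq u v
    go : ∀ {m m′} {φ : Formula k a0 a1 m} → Admissible D φ → ∀ ρ (y : Fin m′) → Admissible D (translate φ ρ y)
    go (adm-wAtom σ x) ρ y = wordAt-admissible y σ _ _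
    go (adm-leq x x′)  ρ y = proj₁ (leqᵇ-admissible (ρ x) (ρ x′))
    go (adm-nleq x x′) ρ y = proj₂ (leqᵇ-admissible (ρ x) (ρ x′))
    go (adm-nul j)     ρ y = nullary-admissible y j
    go (adm-una j x)   ρ y = unary-admissible y j _ _
    go (adm-and p q)   ρ y = adm-and (go p ρ y) (go q ρ y)
    go (adm-or p q)    ρ y = adm-or (go p ρ y) (go q ρ y)
    go (adm-neg p)     ρ y = admissible-negF (go p ρ y)
    go (adm-ex p)      ρ y = adm-ex (admissible-bigOr zero (allFin c) λ r → go p _ (suc y))

  record Interprets {n} (S : Structure g b0 b1 n) (M : Structure k a0 a1 (n * c)) (y : Fin n) : Set where
    field
      wordAt-sound  : ∀ {m} (ν : Fin m → Fin n) {yv} → ν yv ≡ y → ∀ τ v r →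
                      eval S (wordAt yv τ v r) ν ≡ isSym (word M (combine (ν v) r)) τ
      nullary-sound : ∀ {m} (ν : Fin m → Fin n) {yv} → ν yv ≡ y → ∀ j → eval S (nullary yv j) ν ≡ aux0 M j
      unary-sound   : ∀ {m} (ν : Fin m → Fin n) {yv} → ν yv ≡ y → ∀ j v r →
                      eval S (unary yv j v r) ν ≡ aux1 M j (combine (ν v) r)

  module _ {n} {S : Structure g b0 b1 n} {M : Structure k a0 a1 (n * c)} {y : Fin n} (I⊨ : Interprets S M y) where
    open Interprets I⊨

    eval-leqᵇ : ∀ {m} (ν : Fin m → Fin n) p q →
                eval S (leqᵇ p q) ν ≡ ⌊ uncurry combine (map₁ ν p) ≤? uncurry combine (map₁ ν q) ⌋
    eval-leqᵇ ν (v , r) (u , s) rewrite combine-≤? (ν v) (ν u) r s with ⌊ r ≤? s ⌋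
    ... | true  = refl
    ... | false = refl

    eval-translate : ∀ {m m′} (φ : Formula k a0 a1 m) (ρ : Fin m → Fin m′ × Fin c) (ν : Fin m′ → Fin n) {yv} →
                     ν yv ≡ y → eval S (translate φ ρ yv) ν ≡ eval M φ (blockEnv ν ρ)
    eval-translate (wAtom τ x) ρ ν e = wordAt-sound ν e τ _ _
    eval-translate (leq x x′)  ρ ν e = eval-leqᵇ ν (ρ x) (ρ x′)
    eval-translate (nul j)     ρ ν e = nullary-sound ν e j
    eval-translate (una j x)   ρ ν e = unary-sound ν e j _ _
    eval-translate (neg φ)     ρ ν {yv} e =
      trans (eval-negF S (translate φ ρ yv) ν) (cong not (eval-translate φ ρ ν e))
    eval-translate (and φ ψ)   ρ ν e = cong₂ _∧_ (eval-translate φ ρ ν e) (eval-translate ψ ρ ν e)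
    eval-translate (or φ ψ)    ρ ν e = cong₂ _∨_ (eval-translate φ ρ ν e) (eval-translate ψ ρ ν e)
    eval-translate (ex φ)      ρ ν {yv} e = begin
      anyFin (λ a → eval S (bigOr zero (allFin c) (λ r → translate φ (ρ′ r) (suc yv))) (extend a ν))
        ≡⟨ anyFin-cong (λ a → eval-bigOr S zero (allFin c) (λ r → translate φ (ρ′ r) (suc yv)) (extend a ν)) ⟩
      anyFin (λ a → any (λ r → eval S (translate φ (ρ′ r) (suc yv)) (extend a ν)) (allFin c))
        ≡⟨ anyFin-cong (λ a → sym (anyFin≡any (λ r → eval S (translate φ (ρ′ r) (suc yv)) (extend a ν)))) ⟩
      anyFin (λ a → anyFin (λ r → eval S (translate φ (ρ′ r) (suc yv)) (extend a ν)))
        ≡⟨ anyFin-cong (λ a → anyFin-cong λ r →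
             trans (eval-translate φ (ρ′ r) (extend a ν) e) (eval-cong M φ (blockEnv-extend a r))) ⟩
      anyFin {n} (λ a → anyFin {c} (λ r → eval M φ (extend (combine a r) (blockEnv ν ρ))))
        ≡⟨ anyFin-combine n c (λ i → eval M φ (extend i (blockEnv ν ρ))) ⟨
      anyFin (λ i → eval M φ (extend i (blockEnv ν ρ))) ∎
      where
      open ≡-Reasoning
      ρ′ : Fin c → _
      ρ′ r = (zero , r) ◂ (map₁ suc ∘ ρ)
      blockEnv-extend : ∀ a r x → blockEnv (extend a ν) (ρ′ r) x ≡ extend (combine a r) (blockEnv ν ρ) x
      blockEnv-extend a r zero    = refl
      blockEnv-extend a r (suc x) = refl

-- Changes within one block

setWord-≟ : ∀ {k n} (w : WordEnc k n) s i j → setWord w (s , i) j ≡ (if ⌊ j ≟ i ⌋ then s else w j)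
setWord-≟ w s i j with j ≟ i
... | yes _ = refl
... | no _  = refl

combine-≟ : ∀ {n c} (a b : Fin n) (r s : Fin c) → ⌊ combine a r ≟ combine b s ⌋ ≡ ⌊ a ≟ b ⌋ ∧ ⌊ r ≟ s ⌋
combine-≟ a b r s with a ≟ b | r ≟ s
... | yes refl | yes refl = ⌊⌋-true (combine a r ≟ combine a r) refl
... | yes _    | no r≢s   = ⌊⌋-false (combine a r ≟ combine b s) (r≢s ∘ FinP.combine-injectiveʳ a r b s)
... | no a≢b   | _        = ⌊⌋-false (combine a r ≟ combine b s) (a≢b ∘ FinP.combine-injectiveˡ a r b s)

atBlock : ∀ {k n c} → Fin n → Change k c → Change k (n * c)
atBlock y (s , r) = s , combine y r

setWord-block : ∀ {k n c} (w : WordEnc k (n * c)) s (y : Fin n) r′ a r →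
                setWord w (atBlock y (s , r′)) (combine a r)
                  ≡ (if ⌊ a ≟ y ⌋ ∧ ⌊ r ≟ r′ ⌋ then s else w (combine a r))
setWord-block w s y r′ a r =
  trans (setWord-≟ w s (combine y r′) (combine a r))
        (cong (λ b → if b then s else w (combine a r)) (combine-≟ a y r r′))

word-foldl-step : ∀ {k} (P : DynProg k) {n} (M : Structure k (a0 P) (a1 P) n) chs →
                  word (List.foldl (step P) M chs) ≡ List.foldl setWord (word M) chs
word-foldl-step P M []         = refl
word-foldl-step P M (ch ∷ chs) = word-foldl-step P (step P M ch) chs

writeSlots : ∀ {k n c} (y : Fin n) (f : Fin c → Maybe (Fin k)) → List (Fin c) → List (Change k (n * c))
writeSlots y f rs = List.map (atBlock y) (List.map (λ r → f r , r) rs)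

foldl-writeSlots : ∀ {k n c} (y : Fin n) (f : Fin c → Maybe (Fin k)) rs (w : WordEnc k (n * c)) a r →
                   List.foldl setWord w (writeSlots y f rs) (combine a r)
                     ≡ (if ⌊ a ≟ y ⌋ ∧ any (λ r′ → ⌊ r ≟ r′ ⌋) rs then f r else w (combine a r))
foldl-writeSlots y f [] w a r rewrite ∧-zeroʳ ⌊ a ≟ y ⌋ = refl
foldl-writeSlots y f (r′ ∷ rs) w a r
  rewrite foldl-writeSlots y f rs (setWord w (f r′ , combine y r′)) a r | setWord-block w (f r′) y r′ a r
  with r ≟ r′ | ⌊ a ≟ y ⌋
... | yes refl | true  = if-eta (any (λ r″ → ⌊ r ≟ r″ ⌋) rs)
... | yes refl | false = refl
... | no _     | true  = refl
... | no _     | false = refl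

foldl-writeBlock : ∀ {k n c} (y : Fin n) (f : Fin c → Maybe (Fin k)) (w : WordEnc k (n * c)) a r →
                   List.foldl setWord w (writeSlots y f (allFin c)) (combine a r)
                     ≡ (if ⌊ a ≟ y ⌋ then f r else w (combine a r))
foldl-writeBlock {c = c} y f w a r = begin
  List.foldl setWord w (writeSlots y f (allFin c)) (combine a r)
    ≡⟨ foldl-writeSlots y f (allFin c) w a r ⟩
  (if ⌊ a ≟ y ⌋ ∧ any (λ r′ → ⌊ r ≟ r′ ⌋) (allFin c) then f r else w (combine a r))
    ≡⟨ cong (λ b → if ⌊ a ≟ y ⌋ ∧ b then f r else w (combine a r)) every-slot ⟩
  (if ⌊ a ≟ y ⌋ ∧ true then f r else w (combine a r))
    ≡⟨ cong (λ b → if b then f r else w (combine a r)) (∧-identityʳ ⌊ a ≟ y ⌋) ⟩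
  (if ⌊ a ≟ y ⌋ then f r else w (combine a r)) ∎
  where
  open ≡-Reasoning
  every-slot : any (λ r′ → ⌊ r ≟ r′ ⌋) (allFin c) ≡ true
  every-slot = trans (any-cong (⌊≟⌋-sym _≟_ r) (allFin c)) (any-≟ _≟_ (∈-allFin r))

module _ {k g b0 b1 c : ℕ} (P : DynProg k) where

  private
    Interp : Set
    Interp = Interpretation k (a0 P) (a1 P) g b0 b1 c

  overwrite : Interp → Change k c → Interp
  overwrite I (s , r′) = record I { wordAt = wordAt′ }
    where
    open Interpretation I
    wordAt′ : ∀ {m} → Fin m → Fin k → Fin m → Fin c → Formula g b0 b1 m
    wordAt′ y τ v r = if ⌊ r ≟ r′ ⌋
                      then or (and (eqF v y) (constF (isSym s τ) v)) (and (neqF v y) (wordAt y τ v r))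
                      else wordAt y τ v r

  -- Describes the structure after slot r of the block held in the first argument is set to s.
  afterChange : Interp → Change k c → Interp
  afterChange I (s , r) = record
    { wordAt  = Interpretation.wordAt I′
    ; nullary = λ y j → translate I′ (upd0 P j s) (λ _ → (y , r)) y
    ; unary   = λ y j v r₀ → translate I′ (upd1 P j s) ((v , r₀) ◂ λ _ → (y , r)) y
    }
    where I′ = overwrite I (s , r)

  afterChanges : Interp → List (Change k c) → Interp
  afterChanges = List.foldl afterChange

  module _ {D : DynClass} (P∈D : InClass D P) where

    admissible-overwrite : ∀ {I} → AdmissibleAtoms I D → ∀ ch → AdmissibleAtoms (overwrite I ch) D
    admissible-overwrite {I} A (s , r′) = record
      { wordAt-admissible  = wordAt′-admissible
      ; nullary-admissible = nullary-admissible
      ; unary-admissible   = unary-admissible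
      }
      where
      open AdmissibleAtoms A
      wordAt′-admissible : ∀ {m} y τ (v : Fin m) r →
                           Admissible D (Interpretation.wordAt (overwrite I (s , r′)) y τ v r)
      wordAt′-admissible y τ v r with ⌊ r ≟ r′ ⌋
      ... | true  = adm-or (adm-and (admissible-eqF v y) (admissible-constF _ v))
                           (adm-and (admissible-neqF v y) (wordAt-admissible y τ v r))
      ... | false = wordAt-admissible y τ v r

    admissible-afterChanges : ∀ {I} → AdmissibleAtoms I D → ∀ chs → AdmissibleAtoms (afterChanges I chs) D
    admissible-afterChanges A []               = A
    admissible-afterChanges {I} A ((s , r) ∷ chs) = admissible-afterChanges A′ chs
      where
      A′ : AdmissibleAtoms (afterChange I (s , r)) D
      A′ = record
        { wordAt-admissible  = AdmissibleAtoms.wordAt-admissible (admissible-overwrite A (s , r))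
        ; nullary-admissible = λ y j → admissible-translate _ (admissible-overwrite A (s , r))
                                         (updateOK⇒admissible D (proj₁ P∈D j s)) _ y
        ; unary-admissible   = λ y j v r₀ → admissible-translate _ (admissible-overwrite A (s , r))
                                              (updateOK⇒admissible D (proj₂ P∈D j s)) _ y
        }

  module _ {n} {S : Structure g b0 b1 n} {y : Fin n} where

    interprets-overwrite : ∀ {I M} → Interprets I S M y → ∀ ch →
                           Interprets (overwrite I ch) S (record M { word = setWord (word M) (atBlock y ch) }) y
    interprets-overwrite {I} {M} I⊨ (s , r′) = record
      { wordAt-sound = wordAt′-sound ; nullary-sound = nullary-sound ; unary-sound = unary-sound }
      where
      open Interprets I⊨
      wordAt′-sound : ∀ {m} (ν : Fin m → Fin n) {yv} → ν yv ≡ y → ∀ τ v r →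
                      eval S (Interpretation.wordAt (overwrite I (s , r′)) yv τ v r) ν
                        ≡ isSym (setWord (word M) (s , combine y r′) (combine (ν v) r)) τ
      wordAt′-sound ν {yv} refl τ v r
        rewrite setWord-block (word M) s (ν yv) r′ (ν v) r
        with r ≟ r′
      ... | no _ rewrite ∧-zeroʳ ⌊ ν v ≟ ν yv ⌋ = wordAt-sound ν refl τ v r
      ... | yes refl = begin
        (eval S (eqF v yv) ν ∧ eval S (constF (isSym s τ) v) ν)
          ∨ (eval S (neqF v yv) ν ∧ eval S (Interpretation.wordAt I yv τ v r) ν)
          ≡⟨ cong₂ _∨_ (cong₂ _∧_ (eval-eqF S v yv ν) (eval-constF S _ v ν))
                       (cong₂ _∧_ (eval-neqF S v yv ν) (wordAt-sound ν refl τ v r)) ⟩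
        (⌊ ν v ≟ ν yv ⌋ ∧ isSym s τ) ∨ (not ⌊ ν v ≟ ν yv ⌋ ∧ isSym (word M (combine (ν v) r)) τ)
          ≡⟨ ∨-select ⌊ ν v ≟ ν yv ⌋ _ _ ⟩
        (if ⌊ ν v ≟ ν yv ⌋ then isSym s τ else isSym (word M (combine (ν v) r)) τ)
          ≡⟨ if-float (λ x → isSym x τ) ⌊ ν v ≟ ν yv ⌋ ⟨
        isSym (if ⌊ ν v ≟ ν yv ⌋ then s else word M (combine (ν v) r)) τ
          ≡⟨ cong (λ b → isSym (if b then s else word M (combine (ν v) r)) τ) (∧-identityʳ ⌊ ν v ≟ ν yv ⌋) ⟨
        isSym (if ⌊ ν v ≟ ν yv ⌋ ∧ true then s else word M (combine (ν v) r)) τ ∎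
        where open ≡-Reasoning

    interprets-afterChanges : ∀ {I M} → Interprets I S M y → ∀ chs →
                              Interprets (afterChanges I chs) S (List.foldl (step P) M (List.map (atBlock y) chs)) y
    interprets-afterChanges I⊨ []                   = I⊨
    interprets-afterChanges {I} {M} I⊨ ((s , r) ∷ chs) = interprets-afterChanges I⊨′ chs
      where
      I′⊨ = interprets-overwrite I⊨ (s , r)
      open Interprets I′⊨
      I⊨′ : Interprets (afterChange I (s , r)) S (step P M (s , combine y r)) y
      I⊨′ = record
        { wordAt-sound  = wordAt-sound
        ; nullary-sound = λ ν e j → trans (eval-translate _ I′⊨ (upd0 P j s) _ ν e)
                                          (eval-cong _ (upd0 P j s) λ _ → cong (λ a → combine a r) e)
        ; unary-sound   = λ ν e j v r₀ → trans (eval-translate _ I′⊨ (upd1 P j s) _ ν e)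
                                               (eval-cong _ (upd1 P j s) (env e v r₀))
        }
        where
        env : ∀ {m} {ν : Fin m → Fin n} {yv} → ν yv ≡ y → ∀ v r₀ x →
              blockEnv ν ((v , r₀) ◂ λ _ → (yv , r)) x ≡ extend (combine (ν v) r₀) (λ _ → combine y r) x
        env e v r₀ zero    = refl
        env e v r₀ (suc x) = cong (λ a → combine a r) e

-- The marked end

data End : Set where
  first last : End

endPos : End → ∀ {m} → Fin (suc m)
endPos first     = zero
endPos last {m}  = Fin.fromℕ m

isEnd : End → ∀ {m} → Fin (suc m) → Bool
isEnd e a = ⌊ a ≟ endPos e ⌋

isEndF : ∀ {k a0 a1 m} → End → Fin m → Formula k a0 a1 m
isEndF first v = neg (ex (neg (leq (suc v) zero)))
isEndF last  v = neg (ex (neg (leq zero (suc v))))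

¬∃¬-true : ∀ {n} (f : Fin n → Bool) → (∀ i → f i ≡ true) → not (anyFin (not ∘ f)) ≡ true
¬∃¬-true f f≡true = cong not (anyFin-none (not ∘ f) λ i → cong not (f≡true i))

¬∃¬-false : ∀ {n} (f : Fin n → Bool) i → f i ≡ false → not (anyFin (not ∘ f)) ≡ false
¬∃¬-false f i fi≡false = cong not (anyFin-witness (not ∘ f) i (cong not fi≡false))

eval-isEndF : ∀ {k a0 a1 m m′} e (S : Structure k a0 a1 (suc m)) (v : Fin m′) ρ →
              eval S (isEndF e v) ρ ≡ isEnd e (ρ v)
eval-isEndF {m = m} first S v ρ with ρ v
... | zero  = ¬∃¬-true (λ (z : Fin (suc m)) → ⌊ zero {m} ≤? z ⌋) λ z → ⌊⌋-true (zero {m} ≤? z) ℕ.z≤n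
... | suc a = ¬∃¬-false (λ (z : Fin (suc m)) → ⌊ suc a ≤? z ⌋) zero (⌊⌋-false (suc a ≤? zero {m}) λ ())
eval-isEndF {m = m} last S v ρ with ρ v ≟ Fin.fromℕ m
... | yes a≡end = ¬∃¬-true (λ z → ⌊ z ≤? ρ v ⌋) λ z →
                    ⌊⌋-true (z ≤? ρ v) (subst (z Fin.≤_) (sym a≡end) (FinP.≤fromℕ z))
... | no a≢end  = ¬∃¬-false (λ z → ⌊ z ≤? ρ v ⌋) (Fin.fromℕ m) (⌊⌋-false (Fin.fromℕ m ≤? ρ v) end≰a)
  where
  end≰a : ¬ Fin.fromℕ m Fin.≤ ρ v
  end≰a end≤a = a≢end (FinP.≤-antisym (FinP.≤fromℕ (ρ v)) end≤a)

atEndPos : ∀ {k a0 a1 m} → End → Formula k a0 a1 (suc m) → Formula k a0 a1 m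
atEndPos e φ = ex (and (isEndF e zero) φ)

eval-atEndPos : ∀ {k a0 a1 m m′} e (S : Structure k a0 a1 (suc m)) (φ : Formula k a0 a1 (suc m′)) ρ →
                eval S (atEndPos e φ) ρ ≡ eval S φ (extend (endPos e) ρ)
eval-atEndPos {m = m} e S φ ρ = begin
  anyFin (λ a → eval S (isEndF e zero) (extend a ρ) ∧ eval S φ (extend a ρ))
    ≡⟨ anyFin-cong (λ a → cong (_∧ eval S φ (extend a ρ)) (eval-isEndF e S zero (extend a ρ))) ⟩
  anyFin (λ a → ⌊ a ≟ endPos e ⌋ ∧ eval S φ (extend a ρ))
    ≡⟨ anyFin≡any (λ a → ⌊ a ≟ endPos e ⌋ ∧ eval S φ (extend a ρ)) ⟩
  any (λ a → ⌊ a ≟ endPos e ⌋ ∧ eval S φ (extend a ρ)) (allFin (suc m))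
    ≡⟨ any-select _≟_ (∈-allFin (endPos e)) (λ a → eval S φ (extend a ρ)) ⟩
  eval S φ (extend (endPos e) ρ) ∎
  where open ≡-Reasoning

-- Words of blocks

symbols : ∀ {A : Set} {n} → (Fin n → Maybe A) → List A
symbols w = concat (tabulate (fromMaybe ∘ w))

represented≡symbols : ∀ {k n} (w : WordEnc k n) → represented w ≡ symbols w
represented≡symbols {n = n} w = begin
  catSyms (List.map w (allFin n))
    ≡⟨ catSyms≡concatMap (List.map w (allFin n)) ⟩
  concat (List.map fromMaybe (List.map w (allFin n)))
    ≡⟨ cong concat (ListP.map-∘ (allFin n)) ⟨
  concat (List.map (fromMaybe ∘ w) (allFin n))
    ≡⟨ cong concat (ListP.map-tabulate id (fromMaybe ∘ w)) ⟩
  symbols w ∎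
  where
  open ≡-Reasoning
  catSyms≡concatMap : ∀ {k} (xs : List (Maybe (Fin k))) → catSyms xs ≡ concat (List.map fromMaybe xs)
  catSyms≡concatMap []             = refl
  catSyms≡concatMap (nothing ∷ xs) = catSyms≡concatMap xs
  catSyms≡concatMap (just σ ∷ xs)  = cong (σ ∷_) (catSyms≡concatMap xs)

tabulate-↑ : ∀ {A : Set} m n (f : Fin (m + n) → A) →
             tabulate f ≡ tabulate (f ∘ (_↑ˡ n)) ++ tabulate (f ∘ (m ↑ʳ_))
tabulate-↑ zero    n f = refl
tabulate-↑ (suc m) n f = cong (f zero ∷_) (tabulate-↑ m n (f ∘ suc))

tabulate-combine : ∀ {A : Set} m n (f : Fin (m * n) → A) →
                   tabulate f ≡ concat (tabulate {n = m} λ a → tabulate {n = n} λ r → f (combine a r))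
tabulate-combine zero    n f = refl
tabulate-combine (suc m) n f =
  trans (tabulate-↑ n (m * n) f) (cong (tabulate (f ∘ (_↑ˡ m * n)) ++_) (tabulate-combine m n (f ∘ (n ↑ʳ_))))

symbols-combine : ∀ {A : Set} m n (w : Fin (m * n) → Maybe A) →
                  symbols w ≡ concat (tabulate {n = m} λ a → symbols {n = n} λ r → w (combine a r))
symbols-combine {A} m n w = begin
  concat (tabulate (fromMaybe ∘ w))
    ≡⟨ cong concat (tabulate-combine m n (fromMaybe ∘ w)) ⟩
  concat (concat blocks)
    ≡⟨ ListP.concat-concat blocks ⟨
  concat (List.map concat blocks)
    ≡⟨ cong concat (ListP.map-tabulate {n = m} (λ a → tabulate {n = n} λ r → fromMaybe (w (combine a r))) concat) ⟩
  concat (tabulate {n = m} λ a → symbols {n = n} λ r → w (combine a r)) ∎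
  where
  open ≡-Reasoning
  blocks : List (List (List A))
  blocks = tabulate {n = m} λ a → tabulate {n = n} λ r → fromMaybe (w (combine a r))

blockString : ∀ {g k c m} → End → (Bool → Maybe (Fin g) → Fin c → Maybe (Fin k)) → WordEnc g (suc m) → List (Fin k)
blockString e B w = concat (tabulate λ a → symbols (B (isEnd e a) (w a)))

-- The simulating program

-- Position a of the Γ-word w becomes the block B (isEnd e a) (w a); B false nothing must be blank
-- because the initial Γ-word is.
module Simulation {k g : ℕ} (D : DynClass) (P : DynProg k) (P∈D : InClass D P) {c : ℕ} (e : End)
                  (B : Bool → Maybe (Fin g) → Fin c → Maybe (Fin k)) (B-blank : ∀ r → B false nothing r ≡ nothing)
                  where

  _≟ₘ_ : DecidableEquality (Maybe (Fin g))
  _≟ₘ_ = MaybeP.≡-dec _≟_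

  data AuxIndex : Set where
    copy           : Fin (a1 P) → Fin c → AuxIndex
    letter         : Maybe (Fin g) → AuxIndex
    atEnd notAtEnd : AuxIndex

  A1 : ℕ
  A1 = a1 P * c + suc (suc (suc g))

  encode : AuxIndex → Fin A1
  encode (copy j r)        = combine j r ↑ˡ _
  encode atEnd             = a1 P * c ↑ʳ zero
  encode notAtEnd          = a1 P * c ↑ʳ suc zero
  encode (letter nothing)  = a1 P * c ↑ʳ suc (suc zero)
  encode (letter (just γ)) = a1 P * c ↑ʳ suc (suc (suc γ))

  decodeSplit : Fin (a1 P * c) ⊎ Fin (suc (suc (suc g))) → AuxIndex
  decodeSplit (inj₁ p)                   = uncurry copy (Fin.remQuot c p)
  decodeSplit (inj₂ zero)                = atEnd
  decodeSplit (inj₂ (suc zero))          = notAtEnd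
  decodeSplit (inj₂ (suc (suc zero)))    = letter nothing
  decodeSplit (inj₂ (suc (suc (suc γ)))) = letter (just γ)

  decode : Fin A1 → AuxIndex
  decode = decodeSplit ∘ Fin.splitAt (a1 P * c)

  decode-encode : ∀ u → decode (encode u) ≡ u
  decode-encode (copy j r) = trans (cong decodeSplit (FinP.splitAt-↑ˡ (a1 P * c) (combine j r) _))
                                   (cong (uncurry copy) (FinP.remQuot-combine j r))
  decode-encode atEnd             = cong decodeSplit (FinP.splitAt-↑ʳ (a1 P * c) _ zero)
  decode-encode notAtEnd          = cong decodeSplit (FinP.splitAt-↑ʳ (a1 P * c) _ (suc zero))
  decode-encode (letter nothing)  = cong decodeSplit (FinP.splitAt-↑ʳ (a1 P * c) _ (suc (suc zero)))
  decode-encode (letter (just γ)) = cong decodeSplit (FinP.splitAt-↑ʳ (a1 P * c) _ (suc (suc (suc γ))))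

  private
    Fm : ℕ → Set
    Fm = Formula g (a0 P) A1

  letters : List (Maybe (Fin g))
  letters = nothing ∷ List.map just (allFin g)

  ∈-letters : ∀ x → x ∈ letters
  ∈-letters nothing  = here refl
  ∈-letters (just γ) = there (∈-map⁺ just (∈-allFin γ))

  caseLetter : ∀ {m} → Fin m → (Maybe (Fin g) → Fm m) → Fm m
  caseLetter v φ = bigOr v letters λ x → and (una (encode (letter x)) v) (φ x)

  caseEnd : ∀ {m} → Fin m → (Bool → Fm m) → Fm m
  caseEnd v φ = or (and (una (encode atEnd) v) (φ true)) (and (una (encode notAtEnd) v) (φ false))

  current : Interpretation k (a0 P) (a1 P) g (a0 P) A1 c
  current = record
    { wordAt  = λ y τ v r → caseLetter v λ x → caseEnd v λ b → constF (isSym (B b x r) τ) v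
    ; nullary = λ y j → nul j
    ; unary   = λ y j v r → una (encode (copy j r)) v
    }

  blockWrite : Bool → Maybe (Fin g) → List (Change k c)
  blockWrite b x = List.map (λ r → B b x r , r) (allFin c)

  blockChanges : ∀ {n} → Fin n → Bool → Maybe (Fin g) → List (Change k (n * c))
  blockChanges y b x = List.map (atBlock y) (blockWrite b x)

  written : Bool → Maybe (Fin g) → Interpretation k (a0 P) (a1 P) g (a0 P) A1 c
  written b x = afterChanges P current (blockWrite b x)

  upd0-simulated : Fin (a0 P) → Maybe (Fin g) → Fm 1
  upd0-simulated j x = caseEnd zero λ b → Interpretation.nullary (written b x) zero j

  -- Variable zero is the argument of the relation, variable one the changed position.
  upd1-simulated : AuxIndex → Maybe (Fin g) → Fm 2
  upd1-simulated (copy j r)  x = caseEnd (suc zero) λ b → Interpretation.unary (written b x) (suc zero) j zero r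
  upd1-simulated (letter x′) x = or (and (eqF zero (suc zero)) (constF ⌊ x′ ≟ₘ x ⌋ zero))
                                    (and (neqF zero (suc zero)) (una (encode (letter x′)) zero))
  upd1-simulated atEnd       x = una (encode atEnd) zero
  upd1-simulated notAtEnd    x = una (encode notAtEnd) zero

  admissible-caseLetter : ∀ {m} (v : Fin m) {φ} → (∀ x → Admissible D (φ x)) → Admissible D (caseLetter v φ)
  admissible-caseLetter v p = admissible-bigOr v letters λ x → adm-and (adm-una _ v) (p x)

  admissible-caseEnd : ∀ {m} (v : Fin m) {φ} → (∀ b → Admissible D (φ b)) → Admissible D (caseEnd v φ)
  admissible-caseEnd v p = adm-or (adm-and (adm-una _ v) (p true)) (adm-and (adm-una _ v) (p false))

  admissible-written : ∀ b x → AdmissibleAtoms (written b x) D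
  admissible-written b x = admissible-afterChanges P P∈D current-admissible (blockWrite b x)
    where
    current-admissible : AdmissibleAtoms current D
    current-admissible = record
      { wordAt-admissible  = λ y τ v r → admissible-caseLetter v λ x → admissible-caseEnd v λ b →
                                 admissible-constF (isSym (B b x r) τ) v
      ; nullary-admissible = λ y j → adm-nul j
      ; unary-admissible   = λ y j v r → adm-una _ v
      }

  admissible-upd0 : ∀ j x → Admissible D (upd0-simulated j x)
  admissible-upd0 j x = admissible-caseEnd zero λ b → AdmissibleAtoms.nullary-admissible (admissible-written b x) zero j

  admissible-upd1 : ∀ u x → Admissible D (upd1-simulated u x)
  admissible-upd1 (copy j r)  x = admissible-caseEnd (suc zero) λ b →
                                    AdmissibleAtoms.unary-admissible (admissible-written b x) (suc zero) j zero r
  admissible-upd1 (letter x′) x = adm-or (adm-and (admissible-eqF _ _) (admissible-constF _ _))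
                                         (adm-and (admissible-neqF _ _) (adm-una _ _))
  admissible-upd1 atEnd       x = adm-una _ _
  admissible-upd1 notAtEnd    x = adm-una _ _

  emptyInput : Interpretation k 0 0 g 0 0 c
  emptyInput = record { wordAt = λ y τ v r → constF false v ; nullary = λ y () ; unary = λ y () }

  initial : Interpretation k (a0 P) (a1 P) g 0 0 c
  initial = record
    { wordAt  = λ y τ v r → constF false v
    ; nullary = λ y j → translate emptyInput (init0 P j) (λ ()) y
    ; unary   = λ y j v r → translate emptyInput (init1 P j) (λ _ → v , r) y
    }

  started : Interpretation k (a0 P) (a1 P) g 0 0 c
  started = afterChanges P initial (blockWrite true nothing)

  -- b on the empty domain, which holds no block to simulate; false on nonempty ones.
  ifEmpty : Bool → Formula g 0 0 0
  ifEmpty true  = neg (ex (constF true zero))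
  ifEmpty false = ex (constF false zero)

  acceptsBlank : Bool
  acceptsBlank = aux0 (run P (1 * c) (blockChanges (endPos e {0}) true nothing)) (accept P)

  init0-simulated : Fin (a0 P) → Formula g 0 0 0
  init0-simulated j = or (atEndPos e (Interpretation.nullary started zero j)) (ifEmpty acceptsBlank)

  init1-simulated : AuxIndex → Formula g 0 0 1
  init1-simulated (copy j r) = atEndPos e (Interpretation.unary started zero j (suc zero) r)
  init1-simulated (letter x) = constF ⌊ x ≟ₘ nothing ⌋ zero
  init1-simulated atEnd      = isEndF e zero
  init1-simulated notAtEnd   = neg (isEndF e zero)

  P′ : DynProg g
  P′ = record
    { a0 = a0 P ; a1 = A1 ; accept = accept P
    ; upd0 = λ j x → normalize D (admissible-upd0 j x)
    ; upd1 = λ i x → normalize D (admissible-upd1 (decode i) x)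
    ; init0 = init0-simulated
    ; init1 = init1-simulated ∘ decode
    }

  P′∈D : InClass D P′
  P′∈D = (λ j x → normalize-updateOK D (admissible-upd0 j x))
       , (λ i x → normalize-updateOK D (admissible-upd1 (decode i) x))

  record Simulates {m} (S : Structure g (a0 P) A1 (suc m)) (M : Structure k (a0 P) (a1 P) (suc m * c)) : Set where
    field
      word-blocks    : ∀ a r → word M (combine a r) ≡ B (isEnd e a) (word S a) r
      aux0-agrees    : ∀ j → aux0 S j ≡ aux0 M j
      copy-agrees    : ∀ j a r → aux1 S (encode (copy j r)) a ≡ aux1 M j (combine a r)
      letter-holds   : ∀ x a → aux1 S (encode (letter x)) a ≡ ⌊ x ≟ₘ word S a ⌋
      atEnd-holds    : ∀ a → aux1 S (encode atEnd) a ≡ isEnd e a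
      notAtEnd-holds : ∀ a → aux1 S (encode notAtEnd) a ≡ not (isEnd e a)

  module _ {n} (T : Structure g (a0 P) A1 (suc n)) where

    eval-caseLetter : (w : WordEnc g (suc n)) → (∀ x a → aux1 T (encode (letter x)) a ≡ ⌊ x ≟ₘ w a ⌋) →
                      ∀ {m} (v : Fin m) φ ρ → eval T (caseLetter v φ) ρ ≡ eval T (φ (w (ρ v))) ρ
    eval-caseLetter w letter-holds v φ ρ = begin
      eval T (caseLetter v φ) ρ
        ≡⟨ eval-bigOr T v letters (λ x → and (una (encode (letter x)) v) (φ x)) ρ ⟩
      any (λ x → aux1 T (encode (letter x)) (ρ v) ∧ eval T (φ x) ρ) letters
        ≡⟨ any-cong (λ x → cong (_∧ eval T (φ x) ρ) (letter-holds x (ρ v))) letters ⟩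
      any (λ x → ⌊ x ≟ₘ w (ρ v) ⌋ ∧ eval T (φ x) ρ) letters
        ≡⟨ any-select _≟ₘ_ (∈-letters (w (ρ v))) (λ x → eval T (φ x) ρ) ⟩
      eval T (φ (w (ρ v))) ρ ∎
      where open ≡-Reasoning

    eval-caseEnd : (∀ a → aux1 T (encode atEnd) a ≡ isEnd e a) →
                   (∀ a → aux1 T (encode notAtEnd) a ≡ not (isEnd e a)) →
                   ∀ {m} (v : Fin m) φ ρ → eval T (caseEnd v φ) ρ ≡ eval T (φ (isEnd e (ρ v))) ρ
    eval-caseEnd atEnd-holds notAtEnd-holds v φ ρ = begin
      (aux1 T (encode atEnd) (ρ v) ∧ eval T (φ true) ρ) ∨ (aux1 T (encode notAtEnd) (ρ v) ∧ eval T (φ false) ρ)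
        ≡⟨ cong₂ (λ p q → (p ∧ eval T (φ true) ρ) ∨ (q ∧ eval T (φ false) ρ))
                 (atEnd-holds (ρ v)) (notAtEnd-holds (ρ v)) ⟩
      (isEnd e (ρ v) ∧ eval T (φ true) ρ) ∨ (not (isEnd e (ρ v)) ∧ eval T (φ false) ρ)
        ≡⟨ ∨-select (isEnd e (ρ v)) _ _ ⟩
      (if isEnd e (ρ v) then eval T (φ true) ρ else eval T (φ false) ρ)
        ≡⟨ if-true-false (isEnd e (ρ v)) (λ b → eval T (φ b) ρ) ⟩
      eval T (φ (isEnd e (ρ v))) ρ ∎
      where open ≡-Reasoning

  module _ {m} {S : Structure g (a0 P) A1 (suc m)} {M : Structure k (a0 P) (a1 P) (suc m * c)}
           (sim : Simulates S M) (x : Maybe (Fin g)) (y : Fin (suc m)) where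
    open Simulates sim

    private
      S′ : Structure g (a0 P) A1 (suc m)
      S′ = record { word = setWord (word S) (x , y) ; aux0 = aux0 S ; aux1 = aux1 S }

      M′ : Bool → Structure k (a0 P) (a1 P) (suc m * c)
      M′ b = List.foldl (step P) M (blockChanges y b x)

      current⊨ : Interprets current S′ M y
      current⊨ = record
        { wordAt-sound  = λ ν _ τ v r → begin
            eval S′ (caseLetter v λ x → caseEnd v λ b → constF (isSym (B b x r) τ) v) ν
              ≡⟨ eval-caseLetter S′ (word S) letter-holds v (λ x → caseEnd v λ b → constF (isSym (B b x r) τ) v) ν ⟩
            eval S′ (caseEnd v λ b → constF (isSym (B b (word S (ν v)) r) τ) v) ν
              ≡⟨ eval-caseEnd S′ atEnd-holds notAtEnd-holds v (λ b → constF (isSym (B b (word S (ν v)) r) τ) v) ν ⟩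
            eval S′ (constF (isSym (B (isEnd e (ν v)) (word S (ν v)) r) τ) v) ν
              ≡⟨ eval-constF S′ _ v ν ⟩
            isSym (B (isEnd e (ν v)) (word S (ν v)) r) τ
              ≡⟨ cong (λ s → isSym s τ) (word-blocks (ν v) r) ⟨
            isSym (word M (combine (ν v) r)) τ ∎
        ; nullary-sound = λ ν _ j → aux0-agrees j
        ; unary-sound   = λ ν _ j v r → copy-agrees j (ν v) r
        }
        where open ≡-Reasoning

      written⊨ : ∀ b → Interprets (written b x) S′ (M′ b) y
      written⊨ b = interprets-afterChanges P current⊨ (blockWrite b x)

      aux1-step : ∀ u a → aux1 (step P′ S (x , y)) (encode u) a ≡ eval S′ (upd1-simulated u x) (extend a (λ _ → y))
      aux1-step u a =
        trans (cong (λ u′ → eval S′ (normalize D (admissible-upd1 u′ x)) (extend a (λ _ → y))) (decode-encode u))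
              (eval-normalize D S′ (admissible-upd1 u x) (extend a (λ _ → y)))

      after-word : ∀ a r → word (M′ (isEnd e y)) (combine a r) ≡ B (isEnd e a) (setWord (word S) (x , y) a) r
      after-word a r = begin
        word (M′ (isEnd e y)) (combine a r)
          ≡⟨ cong (λ w → w (combine a r)) (word-foldl-step P M (blockChanges y (isEnd e y) x)) ⟩
        List.foldl setWord (word M) (writeSlots y (B (isEnd e y) x) (allFin c)) (combine a r)
          ≡⟨ foldl-writeBlock y (B (isEnd e y) x) (word M) a r ⟩
        (if ⌊ a ≟ y ⌋ then B (isEnd e y) x r else word M (combine a r))
          ≡⟨ written-or-kept ⟩
        B (isEnd e a) (if ⌊ a ≟ y ⌋ then x else word S a) r
          ≡⟨ cong (λ x′ → B (isEnd e a) x′ r) (setWord-≟ (word S) x y a) ⟨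
        B (isEnd e a) (setWord (word S) (x , y) a) r ∎
        where
        open ≡-Reasoning
        written-or-kept : (if ⌊ a ≟ y ⌋ then B (isEnd e y) x r else word M (combine a r))
                          ≡ B (isEnd e a) (if ⌊ a ≟ y ⌋ then x else word S a) r
        written-or-kept with a ≟ y
        ... | yes refl = refl
        ... | no _     = word-blocks a r

      after-aux0 : ∀ j → aux0 (step P′ S (x , y)) j ≡ aux0 (M′ (isEnd e y)) j
      after-aux0 j = begin
        eval S′ (normalize D (admissible-upd0 j x)) (λ _ → y)
          ≡⟨ eval-normalize D S′ (admissible-upd0 j x) (λ _ → y) ⟩
        eval S′ (upd0-simulated j x) (λ _ → y)
          ≡⟨ eval-caseEnd S′ atEnd-holds notAtEnd-holds zero (λ b → Interpretation.nullary (written b x) zero j)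
                          (λ _ → y) ⟩
        eval S′ (Interpretation.nullary (written (isEnd e y) x) zero j) (λ _ → y)
          ≡⟨ Interprets.nullary-sound (written⊨ (isEnd e y)) (λ _ → y) refl j ⟩
        aux0 (M′ (isEnd e y)) j ∎
        where open ≡-Reasoning

      after-copy : ∀ j a r → aux1 (step P′ S (x , y)) (encode (copy j r)) a ≡ aux1 (M′ (isEnd e y)) j (combine a r)
      after-copy j a r = begin
        aux1 (step P′ S (x , y)) (encode (copy j r)) a
          ≡⟨ aux1-step (copy j r) a ⟩
        eval S′ (upd1-simulated (copy j r) x) ρ
          ≡⟨ eval-caseEnd S′ atEnd-holds notAtEnd-holds (suc zero)
                          (λ b → Interpretation.unary (written b x) (suc zero) j zero r) ρ ⟩
        eval S′ (Interpretation.unary (written (isEnd e y) x) (suc zero) j zero r) ρ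
          ≡⟨ Interprets.unary-sound (written⊨ (isEnd e y)) ρ refl j zero r ⟩
        aux1 (M′ (isEnd e y)) j (combine a r) ∎
        where
        open ≡-Reasoning
        ρ : Fin 2 → Fin (suc m)
        ρ = extend a (λ _ → y)

      after-letter : ∀ x′ a →
                     aux1 (step P′ S (x , y)) (encode (letter x′)) a ≡ ⌊ x′ ≟ₘ setWord (word S) (x , y) a ⌋
      after-letter x′ a = begin
        aux1 (step P′ S (x , y)) (encode (letter x′)) a
          ≡⟨ aux1-step (letter x′) a ⟩
        (eval S′ (eqF zero (suc zero)) ρ ∧ eval S′ (constF ⌊ x′ ≟ₘ x ⌋ zero) ρ)
          ∨ (eval S′ (neqF zero (suc zero)) ρ ∧ aux1 S (encode (letter x′)) a)
          ≡⟨ cong₂ _∨_ (cong₂ _∧_ (eval-eqF S′ zero (suc zero) ρ) (eval-constF S′ _ zero ρ))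
                       (cong₂ _∧_ (eval-neqF S′ zero (suc zero) ρ) (letter-holds x′ a)) ⟩
        (⌊ a ≟ y ⌋ ∧ ⌊ x′ ≟ₘ x ⌋) ∨ (not ⌊ a ≟ y ⌋ ∧ ⌊ x′ ≟ₘ word S a ⌋)
          ≡⟨ ∨-select ⌊ a ≟ y ⌋ _ _ ⟩
        (if ⌊ a ≟ y ⌋ then ⌊ x′ ≟ₘ x ⌋ else ⌊ x′ ≟ₘ word S a ⌋)
          ≡⟨ if-float (λ x″ → ⌊ x′ ≟ₘ x″ ⌋) ⌊ a ≟ y ⌋ ⟨
        ⌊ x′ ≟ₘ (if ⌊ a ≟ y ⌋ then x else word S a) ⌋
          ≡⟨ cong (λ x″ → ⌊ x′ ≟ₘ x″ ⌋) (setWord-≟ (word S) x y a) ⟨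
        ⌊ x′ ≟ₘ setWord (word S) (x , y) a ⌋ ∎
        where
        open ≡-Reasoning
        ρ : Fin 2 → Fin (suc m)
        ρ = extend a (λ _ → y)

    simulates-step : Simulates (step P′ S (x , y)) (M′ (isEnd e y))
    simulates-step = record
      { word-blocks    = after-word
      ; aux0-agrees    = after-aux0
      ; copy-agrees    = after-copy
      ; letter-holds   = after-letter
      ; atEnd-holds    = λ a → trans (aux1-step atEnd a) (atEnd-holds a)
      ; notAtEnd-holds = λ a → trans (aux1-step notAtEnd a) (notAtEnd-holds a)
      }

  module _ (m : ℕ) where

    private
      N : ℕ
      N = suc m * c

      -- The structures on which the initialisation formulas of P and P′ are evaluated.
      Eₖ : Structure k 0 0 N
      Eₖ = record { word = emptyWord ; aux0 = λ () ; aux1 = λ () }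

      E : Structure g 0 0 (suc m)
      E = record { word = emptyWord ; aux0 = λ () ; aux1 = λ () }

      emptyInput⊨ : ∀ y → Interprets emptyInput E Eₖ y
      emptyInput⊨ y = record
        { wordAt-sound  = λ ν _ τ v r → eval-constF E false v ν
        ; nullary-sound = λ ν _ ()
        ; unary-sound   = λ ν _ ()
        }

      initial⊨ : ∀ y → Interprets initial E (initStruct P N) y
      initial⊨ y = record
        { wordAt-sound  = λ ν _ τ v r → eval-constF E false v ν
        ; nullary-sound = λ ν ν≡y j → trans (eval-translate emptyInput (emptyInput⊨ y) (init0 P j) (λ ()) ν ν≡y)
                                          (eval-cong Eₖ (init0 P j) λ ())
        ; unary-sound   = λ ν ν≡y j v r → eval-translate emptyInput (emptyInput⊨ y) (init1 P j) (λ _ → v , r) ν ν≡y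
        }

    M₀ : Structure k (a0 P) (a1 P) N
    M₀ = List.foldl (step P) (initStruct P N) (blockChanges (endPos e {m}) true nothing)

    private
      started⊨ : Interprets started E M₀ (endPos e)
      started⊨ = interprets-afterChanges P (initial⊨ (endPos e)) (blockWrite true nothing)

      eval-ifEmpty : ∀ b → eval E (ifEmpty b) noVars ≡ false
      eval-ifEmpty true  = cong not (anyFin-witness (λ a → eval E (constF true zero) (extend a noVars)) zero
                                                    (eval-constF E true zero (extend zero noVars)))
      eval-ifEmpty false = anyFin-none (λ a → eval E (constF false zero) (extend a noVars)) λ a →
                             eval-constF E false zero (extend a noVars)

      aux1-init : ∀ u a → aux1 (initStruct P′ (suc m)) (encode u) a ≡ eval E (init1-simulated u) (λ _ → a)
      aux1-init u a = cong (λ u′ → eval E (init1-simulated u′) (λ _ → a)) (decode-encode u)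

      initial-word : ∀ a r → word M₀ (combine a r) ≡ B (isEnd e a) nothing r
      initial-word a r = begin
        word M₀ (combine a r)
          ≡⟨ cong (λ w → w (combine a r)) (word-foldl-step P (initStruct P N) (blockChanges (endPos e {m}) true nothing)) ⟩
        List.foldl setWord emptyWord (writeSlots (endPos e) (B true nothing) (allFin c)) (combine a r)
          ≡⟨ foldl-writeBlock (endPos e) (B true nothing) emptyWord a r ⟩
        (if ⌊ a ≟ endPos e ⌋ then B true nothing r else nothing)
          ≡⟨ written-or-blank ⟩
        B (isEnd e a) nothing r ∎
        where
        open ≡-Reasoning
        written-or-blank : (if ⌊ a ≟ endPos e ⌋ then B true nothing r else nothing) ≡ B (isEnd e a) nothing r
        written-or-blank with a ≟ endPos e
        ... | yes _ = refl
        ... | no _  = sym (B-blank r)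

      initial-aux0 : ∀ j → aux0 (initStruct P′ (suc m)) j ≡ aux0 M₀ j
      initial-aux0 j = begin
        eval E (atEndPos e (Interpretation.nullary started zero j)) noVars ∨ eval E (ifEmpty acceptsBlank) noVars
          ≡⟨ cong₂ _∨_ (eval-atEndPos e E (Interpretation.nullary started zero j) noVars) (eval-ifEmpty acceptsBlank) ⟩
        eval E (Interpretation.nullary started zero j) (extend (endPos e) noVars) ∨ false
          ≡⟨ ∨-identityʳ _ ⟩
        eval E (Interpretation.nullary started zero j) (extend (endPos e) noVars)
          ≡⟨ Interprets.nullary-sound started⊨ (extend (endPos e) noVars) refl j ⟩
        aux0 M₀ j ∎
        where open ≡-Reasoning

      initial-copy : ∀ j a r → aux1 (initStruct P′ (suc m)) (encode (copy j r)) a ≡ aux1 M₀ j (combine a r)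
      initial-copy j a r = begin
        aux1 (initStruct P′ (suc m)) (encode (copy j r)) a
          ≡⟨ aux1-init (copy j r) a ⟩
        eval E (atEndPos e (Interpretation.unary started zero j (suc zero) r)) (λ _ → a)
          ≡⟨ eval-atEndPos e E (Interpretation.unary started zero j (suc zero) r) (λ _ → a) ⟩
        eval E (Interpretation.unary started zero j (suc zero) r) (extend (endPos e) (λ _ → a))
          ≡⟨ Interprets.unary-sound started⊨ (extend (endPos e) (λ _ → a)) refl j (suc zero) r ⟩
        aux1 M₀ j (combine a r) ∎
        where open ≡-Reasoning

    simulates-init : Simulates (initStruct P′ (suc m)) M₀
    simulates-init = record
      { word-blocks    = initial-word
      ; aux0-agrees    = initial-aux0
      ; copy-agrees    = initial-copy
      ; letter-holds   = λ x a → trans (aux1-init (letter x) a) (eval-constF E _ zero (λ _ → a))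
      ; atEnd-holds    = λ a → trans (aux1-init atEnd a) (eval-isEndF e E zero (λ _ → a))
      ; notAtEnd-holds = λ a → trans (aux1-init notAtEnd a) (cong not (eval-isEndF e E zero (λ _ → a)))
      }

  Reachable : ∀ {m} → Structure g (a0 P) A1 (suc m) → Set
  Reachable {m} S = Σ (List (Change k (suc m * c))) λ css → Simulates S (run P (suc m * c) css)

  reachable-foldl : ∀ {m} {S : Structure g (a0 P) A1 (suc m)} → Reachable S →
                    ∀ cs → Reachable (List.foldl (step P′) S cs)
  reachable-foldl     R           []             = R
  reachable-foldl {m} (css , sim) ((x , y) ∷ cs) =
    reachable-foldl (css ++ chs , subst (Simulates _) run-++ (simulates-step sim x y)) cs
    where
    chs : List (Change k (suc m * c))
    chs = blockChanges y (isEnd e y) x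
    run-++ : List.foldl (step P) (run P (suc m * c) css) chs ≡ run P (suc m * c) (css ++ chs)
    run-++ = sym (ListP.foldl-++ (step P) (initStruct P (suc m * c)) css chs)

  reachable : ∀ m cs → Reachable (run P′ (suc m) cs)
  reachable m = reachable-foldl (blockChanges (endPos e {m}) true nothing , simulates-init m)

  represented-simulated : ∀ {m} {S M} → Simulates {m} S M → represented (word M) ≡ blockString e B (word S)
  represented-simulated {m} {S} {M} sim = begin
    represented (word M)
      ≡⟨ represented≡symbols (word M) ⟩
    symbols (word M)
      ≡⟨ symbols-combine (suc m) c (word M) ⟩
    concat (tabulate {n = suc m} λ a → symbols {n = c} λ r → word M (combine a r))
      ≡⟨ cong concat (ListP.tabulate-cong λ a → cong concat (ListP.tabulate-cong λ r → cong fromMaybe (word-blocks a r))) ⟩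
    blockString e B (word S) ∎
    where
    open ≡-Reasoning
    open Simulates sim

  module _ {L : List (Fin k) → Set} (P-maintains : Maintains P L) {F : List (Fin g) → List (Fin k)}
           (blockString-spec : ∀ {m} (w : WordEnc g (suc m)) → blockString e B w ≡ F (represented w)) where

    accepts : ∀ {m} {S} css → Simulates {m} S (run P (suc m * c) css) →
              (aux0 S (accept P) ≡ true) ⇔ L (F (represented (word S)))
    accepts {m} {S} css sim =
      subst₂ (λ b w → (b ≡ true) ⇔ L w) (sym (Simulates.aux0-agrees sim (accept P)))
             (trans (represented-simulated sim) (blockString-spec (word S))) (P-maintains (suc m * c) css)

    P′-maintains : Maintains P′ (λ w → L (F w))
    P′-maintains zero    []             =
      subst (λ b → (b ≡ true) ⇔ L (F [])) empty-domain
            (accepts (blockChanges (endPos e {0}) true nothing) (simulates-init 0))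
      where
      E⁰ : Structure g 0 0 0
      E⁰ = record { word = emptyWord ; aux0 = λ () ; aux1 = λ () }
      eval-ifEmpty : ∀ b → eval E⁰ (ifEmpty b) noVars ≡ b
      eval-ifEmpty true  = refl
      eval-ifEmpty false = refl
      empty-domain : aux0 (initStruct P′ 1) (accept P) ≡ aux0 (run P′ 0 []) (accept P)
      empty-domain = trans (Simulates.aux0-agrees (simulates-init 0) (accept P)) (sym (eval-ifEmpty acceptsBlank))
    P′-maintains zero    ((_ , ()) ∷ _)
    P′-maintains (suc m) cs             = accepts (proj₁ (reachable m cs)) (proj₂ (reachable m cs))

-- The three reductions

_‼_ : ∀ {A : Set} → List A → ℕ → Maybe A
[]       ‼ i     = nothing
(x ∷ xs) ‼ zero  = just x
(x ∷ xs) ‼ suc i = xs ‼ i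

symbols-nothing : ∀ {A : Set} n → symbols {A} {n} (λ _ → nothing) ≡ []
symbols-nothing zero    = refl
symbols-nothing (suc n) = symbols-nothing n

symbols-‼ : ∀ {A : Set} c (xs : List A) → length xs ℕ.≤ c → symbols {n = c} (λ r → xs ‼ Fin.toℕ r) ≡ xs
symbols-‼ c       []       _             = symbols-nothing c
symbols-‼ (suc c) (x ∷ xs) (ℕ.s≤s |xs|≤c) = cong (x ∷_) (symbols-‼ c xs |xs|≤c)

module _ {g k : ℕ} (h : Fin g → List (Fin k)) where

  width : ℕ
  width = max 0 (List.map (length ∘ h) (allFin g))

  length≤width : ∀ γ → length (h γ) ℕ.≤ width
  length≤width γ =
    All.lookup (xs≤max 0 (List.map (length ∘ h) (allFin g))) (∈-map⁺ (length ∘ h) (∈-allFin γ))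

  imageBlock : Bool → Maybe (Fin g) → Fin width → Maybe (Fin k)
  imageBlock _ x r = maybe′ (λ γ → h γ ‼ Fin.toℕ r) nothing x

  concatMap-represented : ∀ {n} (w : WordEnc g n) →
                          concatMap h (represented w) ≡ concat (tabulate (maybe′ h [] ∘ w))
  concatMap-represented {n} w = begin
    concatMap h (catSyms (List.map w (allFin n)))         ≡⟨ concatMap-catSyms (List.map w (allFin n)) ⟩
    concat (List.map (maybe′ h []) (List.map w (allFin n))) ≡⟨ cong concat (ListP.map-∘ (allFin n)) ⟨
    concat (List.map (maybe′ h [] ∘ w) (allFin n))        ≡⟨ cong concat (ListP.map-tabulate id (maybe′ h [] ∘ w)) ⟩
    concat (tabulate (maybe′ h [] ∘ w))                   ∎
    where
    open ≡-Reasoning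
    concatMap-catSyms : ∀ xs → concatMap h (catSyms xs) ≡ concat (List.map (maybe′ h []) xs)
    concatMap-catSyms []             = refl
    concatMap-catSyms (nothing ∷ xs) = concatMap-catSyms xs
    concatMap-catSyms (just γ ∷ xs)  = cong (h γ ++_) (concatMap-catSyms xs)

  blockString-imageBlock : ∀ {m} e (w : WordEnc g (suc m)) → blockString e imageBlock w ≡ concatMap h (represented w)
  blockString-imageBlock e w =
    trans (cong concat (ListP.tabulate-cong λ a → symbols-imageBlock (isEnd e a) (w a))) (sym (concatMap-represented w))
    where
    symbols-imageBlock : ∀ b x → symbols (imageBlock b x) ≡ maybe′ h [] x
    symbols-imageBlock b nothing  = symbols-nothing width
    symbols-imageBlock b (just γ) = symbols-‼ width (h γ) (length≤width γ)

module _ {k : ℕ} (σ : Fin k) where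

  marked : Bool → Maybe (Fin k)
  marked b = if b then just σ else nothing

  prefixBlock suffixBlock : Bool → Maybe (Fin k) → Fin 2 → Maybe (Fin k)
  prefixBlock b x zero       = marked b
  prefixBlock b x (suc zero) = x
  suffixBlock b x zero       = x
  suffixBlock b x (suc zero) = marked b

  prefixBlock-blank : ∀ r → prefixBlock false nothing r ≡ nothing
  prefixBlock-blank zero       = refl
  prefixBlock-blank (suc zero) = refl

  suffixBlock-blank : ∀ r → suffixBlock false nothing r ≡ nothing
  suffixBlock-blank zero       = refl
  suffixBlock-blank (suc zero) = refl

  blockString-prefixBlock : ∀ {m} (w : WordEnc k (suc m)) → blockString first prefixBlock w ≡ σ ∷ represented w
  blockString-prefixBlock w = cong (σ ∷_) (begin
    concat (tabulate λ a → fromMaybe (w a) ++ [])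
      ≡⟨ cong concat (ListP.tabulate-cong λ a → ListP.++-identityʳ (fromMaybe (w a))) ⟩
    symbols w
      ≡⟨ represented≡symbols w ⟨
    represented w ∎)
    where open ≡-Reasoning

  concat-marked-last : ∀ m (f : Fin (suc m) → List (Fin k)) →
                       concat (tabulate λ a → f a ++ (fromMaybe (marked ⌊ a ≟ Fin.fromℕ m ⌋) ++ []))
                         ≡ concat (tabulate f) ++ (σ ∷ [])
  concat-marked-last zero    f =
    trans (ListP.++-identityʳ (f zero ++ (σ ∷ []))) (cong (_++ (σ ∷ [])) (sym (ListP.++-identityʳ (f zero))))
  concat-marked-last (suc m) f = begin
    (f zero ++ []) ++ concat (tabulate λ a → f (suc a) ++ (fromMaybe (marked ⌊ suc a ≟ suc (Fin.fromℕ m) ⌋) ++ []))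
      ≡⟨ cong (λ xs → (f zero ++ []) ++ concat xs) (ListP.tabulate-cong λ a →
           cong (λ b → f (suc a) ++ (fromMaybe (marked b) ++ []))
                (⌊⌋-map′ (cong suc) FinP.suc-injective (a ≟ Fin.fromℕ m))) ⟩
    (f zero ++ []) ++ concat (tabulate λ a → f (suc a) ++ (fromMaybe (marked ⌊ a ≟ Fin.fromℕ m ⌋) ++ []))
      ≡⟨ cong₂ _++_ (ListP.++-identityʳ (f zero)) (concat-marked-last m (f ∘ suc)) ⟩
    f zero ++ (concat (tabulate (f ∘ suc)) ++ (σ ∷ []))
      ≡⟨ ListP.++-assoc (f zero) _ (σ ∷ []) ⟨
    concat (tabulate f) ++ (σ ∷ []) ∎
    where open ≡-Reasoning

  blockString-suffixBlock : ∀ {m} (w : WordEnc k (suc m)) → blockString last suffixBlock w ≡ represented w ++ (σ ∷ [])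
  blockString-suffixBlock {m} w =
    trans (concat-marked-last m (fromMaybe ∘ w)) (cong (_++ (σ ∷ [])) (sym (represented≡symbols w)))

memberIn-reduce : ∀ {g k c} {D : DynClass} (L : List (Fin k) → Set) e (B : Bool → Maybe (Fin g) → Fin c → Maybe (Fin k)) →
                  (∀ r → B false nothing r ≡ nothing) → {F : List (Fin g) → List (Fin k)} →
                  (∀ {m} (w : WordEnc g (suc m)) → blockString e B w ≡ F (represented w)) →
                  MemberIn D L → MemberIn D (λ w → L (F w))
memberIn-reduce {D = D} L e B B-blank {F} spec (P , P∈D , P-maintains) =
  P′ , P′∈D , P′-maintains {L} P-maintains {F} spec
  where open Simulation D P P∈D e B B-blank

mainTheorem4 : (k : ℕ) (L : List (Fin k) → Set) (D : DynClass) → MemberIn D L →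
    ((g : ℕ) (h : Fin g → List (Fin k)) → MemberIn D (preimage h L))
    × ((σ : Fin k) → MemberIn D (rightQuot L σ) × MemberIn D (leftQuot L σ))
mainTheorem4 k L D L∈D =
  (λ g h → memberIn-reduce L first (imageBlock h) (λ _ → refl) {concatMap h} (blockString-imageBlock h first) L∈D) ,
  (λ σ → memberIn-reduce L last (suffixBlock σ) (suffixBlock-blank σ) {_++ σ ∷ []} (blockString-suffixBlock σ) L∈D ,
         memberIn-reduce L first (prefixBlock σ) (prefixBlock-blank σ) {σ ∷_} (blockString-prefixBlock σ) L∈D)
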